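{- Let $w\in S_n$ and $w'\in S_k$, and let $w''\in S_{n+k}$ have one-line notation $w'(1)+n,\dots,w'(k)+n,w(1),\dots,w(n)$. Then $\mathfrak G_{w''}(x_1,\dots,x_{n+k})=\mathfrak G_w(x_{k+1},\dots,x_{k+n})\,\mathfrak G_{w'}(x_1,\dots,x_k)\prod_{i=1}^k x_i^n$.
   Context: Grothendieck polynomials: for $w\in S_N$, $\mathfrak G_w\in\mathbb Z[x_1,\dots,x_N]$ is defined by $\mathfrak G_{w_0}=x_1^{N-1}\cdots x_{N-1}$ for $w_0=N\,(N-1)\cdots1$, and $\mathfrak G_w=\partial_i((1-x_{i+1})\mathfrak G_{ws_i})$ whenever $w(i)<w(i+1)$, where $ws_i$ swaps entries in positions $i,i+1$ and $\partial_if=(f-s_if)/(x_i-x_{i+1})$; $\mathfrak G_w(y_1,\dots,y_N)$ denotes the result of substituting $y_i$ for $x_i$. -}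

module Defs where

open import Data.Nat as ℕ using (ℕ; zero; suc; _∸_)
open import Data.Nat.Properties as ℕP using (+-comm)
open import Data.Integer as ℤ using (ℤ; +_)
open import Data.Fin as Fin using (Fin; toℕ; inject₁; _↑ˡ_; _↑ʳ_; cast)
open import Data.Fin.Permutation using (Permutation′; _⟨$⟩ʳ_; _∘ₚ_; transpose)
open import Data.Vec as Vec using (Vec; lookup; tabulate; zipWith; replicate)
open import Data.Vec.Properties as VecP using ()
open import Data.List as List using (List; []; _∷_; _++_; map; concatMap; foldr; allFin)
open import Data.Product using (_×_; _,_)
open import Data.Bool using (if_then_else_)
open import Relation.Nullary using (yes; no; does)
open import Relation.Binary.PropositionalEquality using (_≡_)

-- Polynomials in ℤ[x₁,…,x_N]
-- A monomial is its exponent vector (position j = exponent of x_{j+1});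
-- a polynomial is a finite list of (coefficient, monomial) terms.

Mon : ℕ → Set
Mon N = Vec ℕ N

Poly : ℕ → Set
Poly N = List (ℤ × Mon N)

_≟ₘ_ : ∀ {N} (e f : Mon N) → _
_≟ₘ_ = VecP.≡-dec ℕP._≟_

coeff : ∀ {N} → Poly N → Mon N → ℤ
coeff [] e = + 0
coeff ((c , f) ∷ p) e = (if does (f ≟ₘ e) then c else + 0) ℤ.+ coeff p e

infix 4 _≈_
_≈_ : ∀ {N} → Poly N → Poly N → Set
p ≈ q = ∀ e → coeff p e ≡ coeff q e

term : ∀ {N} → ℤ → Mon N → Poly N
term c e = (c , e) ∷ []

zeroMon : ∀ {N} → Mon N
zeroMon = replicate _ 0

1ₚ : ∀ {N} → Poly N
1ₚ = term (+ 1) zeroMon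

-- the variable x_{j+1} (0-indexed j)
var : ∀ {N} → Fin N → Poly N
var j = term (+ 1) (tabulate λ l → if does (l Fin.≟ j) then 1 else 0)

infixl 6 _+ₚ_ _-ₚ_
infixl 7 _*ₚ_

_+ₚ_ : ∀ {N} → Poly N → Poly N → Poly N
p +ₚ q = p ++ q

-ₚ_ : ∀ {N} → Poly N → Poly N
-ₚ p = map (λ { (c , e) → (ℤ.- c , e) }) p

_-ₚ_ : ∀ {N} → Poly N → Poly N → Poly N
p -ₚ q = p +ₚ (-ₚ q)

_*ₚ_ : ∀ {N} → Poly N → Poly N → Poly N
p *ₚ q = concatMap (λ { (c , e) → map (λ { (d , f) → (c ℤ.* d , zipWith ℕ._+_ e f) }) q }) p

-- Substitution of variables: x_{j+1} ↦ y_{σ(j)+1}, i.e. the ring map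
-- ℤ[x₁..x_N] → ℤ[y₁..y_M] induced by σ on variables.
renameMon : ∀ {N M} → (Fin N → Fin M) → Mon N → Mon M
renameMon {N} {M} σ e =
  foldr (zipWith ℕ._+_) zeroMon
    (map (λ j → tabulate λ l → if does (l Fin.≟ σ j) then lookup e j else 0) (allFin N))

rename : ∀ {N M} → (Fin N → Fin M) → Poly N → Poly M
rename σ p = map (λ { (c , e) → (c , renameMon σ e) }) p

-- Divided difference ∂_i f = (f - s_i f)/(x_i - x_{i+1}),
-- acting on the variables at (0-indexed) positions a = inject₁ i, b = suc i.
-- On a monomial x_a^p x_b^q r this exact quotient is
--   p ≥ q :  Σ_{j<p-q} x_a^{p-1-j} x_b^{q+j} r
--   p < q : -Σ_{j<q-p} x_a^{q-1-j} x_b^{p+j} r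

setExp : ∀ {N} → Mon N → Fin N → ℕ → Mon N
setExp e j v = Vec.updateAt e j (λ _ → v)

ddMon : ∀ {m} → Fin m → ℤ → Mon (suc m) → Poly (suc m)
ddMon {m} i c e with lookup e (inject₁ i) | lookup e (Fin.suc i)
... | p | q with q ℕ.≤? p
...   | yes _ = map (λ j → (c , setExp (setExp e (inject₁ i) (p ∸ suc j)) (Fin.suc i) (q ℕ.+ j)))
                     (List.upTo (p ∸ q))
...   | no _  = map (λ j → (ℤ.- c , setExp (setExp e (inject₁ i) (q ∸ suc j)) (Fin.suc i) (p ℕ.+ j)))
                     (List.upTo (q ∸ p))

∂ : ∀ {m} → Fin m → Poly (suc m) → Poly (suc m)
∂ i f = concatMap (λ { (c , e) → ddMon i c e }) f

oneLine : ∀ {N} → Permutation′ N → List ℕ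
oneLine {N} w = map (λ j → suc (toℕ (w ⟨$⟩ʳ j))) (allFin N)

-- w s_i : swap the entries in positions i, i+1 (0-indexed inject₁ i, suc i)
_·s_ : ∀ {m} → Permutation′ (suc m) → Fin m → Permutation′ (suc m)
w ·s i = transpose (inject₁ i) (Fin.suc i) ∘ₚ w

data Ascent {m} (w : Permutation′ (suc m)) : Set where
  none : Ascent w
  at   : Fin m → Ascent w

firstAscent : ∀ {m} (w : Permutation′ (suc m)) → Ascent w
firstAscent {m} w = go (allFin m)
  where
  go : List (Fin m) → Ascent w
  go [] = none
  go (i ∷ is) with (w ⟨$⟩ʳ inject₁ i) Fin.<? (w ⟨$⟩ʳ Fin.suc i)
  ... | yes _ = at i
  ... | no _  = go is

-- Grothendieck polynomials
-- G_{w₀} = x₁^{N-1} x₂^{N-2} ⋯ x_{N-1};  G_w = ∂_i((1 - x_{i+1}) G_{w s_i})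
-- where i is an ascent of w (we take the first ascent; w has no ascent
-- iff w = w₀). Recursion is by fuel; N*N steps suffice since ℓ(w s_i) = ℓ(w)+1.

Gw₀ : ∀ N → Poly N
Gw₀ N = term (+ 1) (tabulate λ j → N ∸ suc (toℕ j))

Gaux : ∀ {m} → ℕ → Permutation′ (suc m) → Poly (suc m)
Gaux zero w = []
Gaux {m} (suc fuel) w with firstAscent w
... | none = Gw₀ (suc m)
... | at i = ∂ i ((1ₚ -ₚ var (Fin.suc i)) *ₚ Gaux fuel (w ·s i))

𝔊 : ∀ N → Permutation′ N → Poly N
𝔊 zero w = 1ₚ
𝔊 (suc m) w = Gaux (suc m ℕ.* suc m) w

-- x_{j+1} ↦ x_{k+j+1}   (for j : Fin n)
shiftVar : ∀ n k → Fin n → Fin (n ℕ.+ k)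
shiftVar n k j = cast (+-comm k n) (k ↑ʳ j)

-- x_{j+1} ↦ x_{j+1}   (for j : Fin k)
lowVar : ∀ n k → Fin k → Fin (n ℕ.+ k)
lowVar n k j = cast (+-comm k n) (j ↑ˡ n)

lowPower : ∀ n k → Poly (n ℕ.+ k)
lowPower n k = term (+ 1) (tabulate λ l → if does (toℕ l ℕ.<? k) then n else 0)

-- Write w″ = (w′ + n) w. The first ascent of w″ is the first ascent i of w′ if w′ has one; otherwise it is
-- k + i for the first ascent i of w, since the junction of the two blocks is a descent (w′ + n > w). Either
-- way w″ sᵢ is again such a concatenation, of (w′ sᵢ, w) or of (w′, w sᵢ), and the identity follows by
-- induction on the length: the operator πᵢ f = ∂ᵢ((1 - x_{i+1}) f) of the recursion commutes with moving the
-- variables of a block into place, and with multiplication by the remaining factors, which are symmetric in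
-- the two variables involved because these lie in the other block, where ∏_{j≤k} x_jⁿ has equal exponents.
-- When neither block has an ascent, all three permutations are longest elements and the identity says that
-- the staircase monomial of size n + k is the product of the staircases of sizes n (shifted) and k and of
-- ∏_{j≤k} x_jⁿ.

module Submission where

open import Defs
open import Data.Nat using (ℕ; _+_)
open import Data.List using (map; _++_)
open import Data.Fin.Permutation using (Permutation′)
open import Relation.Binary.PropositionalEquality using (_≡_)

open import Algebra.Bundles using (CommutativeSemigroup)
import Algebra.Properties.CommutativeSemigroup as CommutativeSemigroupProperties
open import Algebra.Structures using (IsCommutativeSemigroup)
open import Data.Bool using (true; false; if_then_else_)
open import Data.Fin as Fin using (Fin; toℕ; inject₁)
open import Data.Fin.Permutation using (_⟨$⟩ʳ_; transpose)
import Data.Fin.Properties as FinP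
open import Data.Integer using (ℤ; +_) renaming (_+_ to _+ℤ_; _*_ to _*ℤ_; -_ to -ℤ_)
import Data.Integer.Properties as ℤP
open import Data.Integer.Tactic.RingSolver using (solve-∀)
open import Data.List as List using (List; []; _∷_; concatMap; length; upTo; foldr; allFin)
import Data.List.Properties as ListP
open import Data.List.Relation.Unary.All as All using (All; []; _∷_)
import Data.List.Relation.Unary.All.Properties as AllP
import Data.Nat as ℕ
open import Data.Nat using (zero; suc; _∸_; _≤_; _<_; z≤n; s≤s; _≤?_; _<?_)
open import Data.Nat.ListAction using (sum)
import Data.Nat.Properties as ℕP
import Algebra.Properties.CommutativeMonoid.Sum ℕP.+-0-commutativeMonoid as FinSum
open import Data.Product using (_×_; _,_; proj₁; proj₂; Σ)
open import Data.Vec using (Vec; lookup; zipWith; tabulate)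
import Data.Vec.Properties as VecP
open import Data.Vec.Relation.Binary.Pointwise.Inductive using (Pointwise-≡⇒≡; zipWith-comm; zipWith-assoc)
open import Function using (_∘_; id)
open import Function.Definitions using (Injective)
open import Relation.Binary.Definitions using (tri<; tri≈; tri>)
open import Relation.Binary.PropositionalEquality
  using (refl; sym; trans; cong; cong₂; subst; subst₂; _≗_; module ≡-Reasoning)
open import Relation.Nullary using (yes; no; does; ¬_; Dec)
open import Relation.Nullary.Decidable using (dec-true; dec-false)
open import Relation.Nullary.Negation using (contradiction)

-- Linear functionals on ℤ[x]

∑ : {A : Set} → (A → ℤ) → List A → ℤ
∑ f []       = + 0
∑ f (x ∷ xs) = f x +ℤ ∑ f xs

module _ {A : Set} where

  ∑-++ : ∀ (f : A → ℤ) xs ys → ∑ f (xs ++ ys) ≡ ∑ f xs +ℤ ∑ f ys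
  ∑-++ f []       ys = sym (ℤP.+-identityˡ _)
  ∑-++ f (x ∷ xs) ys = trans (cong (f x +ℤ_) (∑-++ f xs ys)) (sym (ℤP.+-assoc (f x) _ _))

  ∑-cong : ∀ {f g : A → ℤ} → f ≗ g → ∀ xs → ∑ f xs ≡ ∑ g xs
  ∑-cong f≗g []       = refl
  ∑-cong f≗g (x ∷ xs) = cong₂ _+ℤ_ (f≗g x) (∑-cong f≗g xs)

  ∑-+ : ∀ (f g : A → ℤ) xs → ∑ (λ x → f x +ℤ g x) xs ≡ ∑ f xs +ℤ ∑ g xs
  ∑-+ f g []       = refl
  ∑-+ f g (x ∷ xs) =
    trans (cong (f x +ℤ g x +ℤ_) (∑-+ f g xs)) (+-interchange (f x) (g x) (∑ f xs) (∑ g xs))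
    where
    +-interchange : ∀ a b c d → (a +ℤ b) +ℤ (c +ℤ d) ≡ (a +ℤ c) +ℤ (b +ℤ d)
    +-interchange = solve-∀

  ∑-*ˡ : ∀ c (f : A → ℤ) xs → ∑ (λ x → c *ℤ f x) xs ≡ c *ℤ ∑ f xs
  ∑-*ˡ c f []       = sym (ℤP.*-zeroʳ c)
  ∑-*ˡ c f (x ∷ xs) = trans (cong (c *ℤ f x +ℤ_) (∑-*ˡ c f xs)) (sym (ℤP.*-distribˡ-+ c (f x) _))

  ∑-zero : ∀ (xs : List A) → ∑ (λ _ → + 0) xs ≡ + 0
  ∑-zero []       = refl
  ∑-zero (x ∷ xs) = trans (ℤP.+-identityˡ _) (∑-zero xs)

module _ {A B : Set} where

  ∑-map : ∀ (f : B → ℤ) (g : A → B) xs → ∑ f (map g xs) ≡ ∑ (f ∘ g) xs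
  ∑-map f g []       = refl
  ∑-map f g (x ∷ xs) = cong (f (g x) +ℤ_) (∑-map f g xs)

  ∑-concatMap : ∀ (f : B → ℤ) (g : A → List B) xs →
                ∑ f (concatMap g xs) ≡ ∑ (λ x → ∑ f (g x)) xs
  ∑-concatMap f g []       = refl
  ∑-concatMap f g (x ∷ xs) =
    trans (∑-++ f (g x) (concatMap g xs)) (cong (∑ f (g x) +ℤ_) (∑-concatMap f g xs))

  ∑-swap : ∀ (f : A → B → ℤ) xs ys →
           ∑ (λ x → ∑ (f x) ys) xs ≡ ∑ (λ y → ∑ (λ x → f x y) xs) ys
  ∑-swap f []       ys = sym (∑-zero ys)
  ∑-swap f (x ∷ xs) ys = trans (cong (∑ (f x) ys +ℤ_) (∑-swap f xs ys))
    (sym (∑-+ (f x) (λ y → ∑ (λ x → f x y) xs) ys))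

module _ {N : ℕ} where

  δ : Mon N → Mon N → ℤ
  δ f e = if does (f ≟ₘ e) then + 1 else + 0

  linearExt : (Mon N → ℤ) → Poly N → ℤ
  linearExt K = ∑ (λ t → proj₁ t *ℤ K (proj₂ t))

  coeff≡linearExt : ∀ (p : Poly N) e → coeff p e ≡ linearExt (λ f → δ f e) p
  coeff≡linearExt []            e = refl
  coeff≡linearExt ((c , f) ∷ p) e = cong₂ _+ℤ_ (if-scale (does (f ≟ₘ e))) (coeff≡linearExt p e)
    where
    if-scale : ∀ b → (if b then c else + 0) ≡ c *ℤ (if b then + 1 else + 0)
    if-scale true  = sym (ℤP.*-identityʳ c)
    if-scale false = sym (ℤP.*-zeroʳ c)

  coeff-++ : ∀ (p q : Poly N) e → coeff (p ++ q) e ≡ coeff p e +ℤ coeff q e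
  coeff-++ p q e = begin
    coeff (p ++ q) e                         ≡⟨ coeff≡linearExt (p ++ q) e ⟩
    linearExt δₑ (p ++ q)                    ≡⟨ ∑-++ _ p q ⟩
    linearExt δₑ p +ℤ linearExt δₑ q         ≡⟨ cong₂ _+ℤ_ (coeff≡linearExt p e) (coeff≡linearExt q e) ⟨
    coeff p e +ℤ coeff q e                   ∎
    where
    open ≡-Reasoning
    δₑ = λ f → δ f e

  linearExt-neg : ∀ K (p : Poly N) → linearExt K (-ₚ p) ≡ -ℤ linearExt K p
  linearExt-neg K []            = refl
  linearExt-neg K ((c , f) ∷ p) =
    trans (cong₂ _+ℤ_ (sym (ℤP.neg-distribˡ-* c (K f))) (linearExt-neg K p))
          (sym (ℤP.neg-distrib-+ (c *ℤ K f) (linearExt K p)))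

  coeff-neg : ∀ (p : Poly N) e → coeff (-ₚ p) e ≡ -ℤ coeff p e
  coeff-neg p e = trans (coeff≡linearExt (-ₚ p) e)
    (trans (linearExt-neg _ p) (cong -ℤ_ (sym (coeff≡linearExt p e))))

  without : Mon N → Poly N → Poly N
  without f []            = []
  without f ((c , g) ∷ p) = if does (g ≟ₘ f) then without f p else (c , g) ∷ without f p

  length-without : ∀ f (p : Poly N) → length (without f p) ≤ length p
  length-without f []            = z≤n
  length-without f ((c , g) ∷ p) with does (g ≟ₘ f)
  ... | true  = ℕP.m≤n⇒m≤1+n (length-without f p)
  ... | false = s≤s (length-without f p)

  coeff-without-≡ : ∀ f (p : Poly N) → coeff (without f p) f ≡ + 0
  coeff-without-≡ f []            = refl
  coeff-without-≡ f ((c , g) ∷ p) with g ≟ₘ f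
  ... | yes _ = coeff-without-≡ f p
  ... | no g≢f with g ≟ₘ f
  ...   | yes g≡f = contradiction g≡f g≢f
  ...   | no _    = trans (ℤP.+-identityˡ _) (coeff-without-≡ f p)

  coeff-without-≢ : ∀ f (p : Poly N) e → ¬ e ≡ f → coeff (without f p) e ≡ coeff p e
  coeff-without-≢ f []            e e≢f = refl
  coeff-without-≢ f ((c , g) ∷ p) e e≢f with g ≟ₘ f
  ... | no _       = cong ((if does (g ≟ₘ e) then c else + 0) +ℤ_) (coeff-without-≢ f p e e≢f)
  ... | yes refl with g ≟ₘ e
  ...   | yes g≡e = contradiction (sym g≡e) e≢f
  ...   | no _    = trans (coeff-without-≢ f p e e≢f) (sym (ℤP.+-identityˡ _))

  linearExt-without : ∀ K f (p : Poly N) → linearExt K p ≡ coeff p f *ℤ K f +ℤ linearExt K (without f p)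
  linearExt-without K f []            = refl
  linearExt-without K f ((c , g) ∷ p) with g ≟ₘ f
  ... | yes refl = trans (cong (c *ℤ K g +ℤ_) (linearExt-without K g p))
                         (collect c (coeff p g) (K g) (linearExt K (without g p)))
    where
    collect : ∀ a b k l → a *ℤ k +ℤ (b *ℤ k +ℤ l) ≡ (a +ℤ b) *ℤ k +ℤ l
    collect = solve-∀
  ... | no _     = trans (cong (c *ℤ K g +ℤ_) (linearExt-without K f p))
                         (commute (c *ℤ K g) (coeff p f) (K f) (linearExt K (without f p)))
    where
    commute : ∀ a b k l → a +ℤ (b *ℤ k +ℤ l) ≡ (+ 0 +ℤ b) *ℤ k +ℤ (a +ℤ l)
    commute = solve-∀

  linearExt-null : ∀ K (p : Poly N) → (∀ e → coeff p e ≡ + 0) → linearExt K p ≡ + 0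
  linearExt-null K p = bounded (length p) p ℕP.≤-refl
    where
    length-without-head : ∀ c f (p : Poly N) → length (without f ((c , f) ∷ p)) ≤ length p
    length-without-head c f p with f ≟ₘ f
    ... | yes _  = length-without f p
    ... | no f≢f = contradiction refl f≢f

    without-null : ∀ f (p : Poly N) → (∀ e → coeff p e ≡ + 0) → ∀ e → coeff (without f p) e ≡ + 0
    without-null f p p≈0 e with e ≟ₘ f
    ... | yes refl = coeff-without-≡ f p
    ... | no e≢f   = trans (coeff-without-≢ f p e e≢f) (p≈0 e)

    bounded : ∀ n (p : Poly N) → length p ≤ n → (∀ e → coeff p e ≡ + 0) → linearExt K p ≡ + 0
    bounded n       []            _             _   = refl
    bounded (suc n) ((c , f) ∷ p) (s≤s |p|≤n) p≈0 = begin
      linearExt K ((c , f) ∷ p)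
        ≡⟨ linearExt-without K f ((c , f) ∷ p) ⟩
      coeff ((c , f) ∷ p) f *ℤ K f +ℤ linearExt K p′
        ≡⟨ cong₂ (λ a b → a *ℤ K f +ℤ b) (p≈0 f) p′-null ⟩
      + 0 *ℤ K f +ℤ + 0
        ≡⟨ trans (ℤP.+-identityʳ _) (ℤP.*-zeroˡ (K f)) ⟩
      + 0 ∎
      where
      open ≡-Reasoning
      p′ = without f ((c , f) ∷ p)
      p′-null : linearExt K p′ ≡ + 0
      p′-null = bounded n p′ (ℕP.≤-trans (length-without-head c f p) |p|≤n)
                               (without-null f ((c , f) ∷ p) p≈0)

  linearExt-cong : ∀ K {p q : Poly N} → p ≈ q → linearExt K p ≡ linearExt K q
  linearExt-cong K {p} {q} p≈q = ℤP.i-j≡0⇒i≡j _ _ (begin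
    linearExt K p +ℤ -ℤ linearExt K q             ≡⟨ cong (linearExt K p +ℤ_) (sym (linearExt-neg K q)) ⟩
    linearExt K p +ℤ linearExt K (-ₚ q)           ≡⟨ sym (∑-++ _ p (-ₚ q)) ⟩
    linearExt K (p -ₚ q)                          ≡⟨ linearExt-null K (p -ₚ q) p-q≈0 ⟩
    + 0                                           ∎)
    where
    open ≡-Reasoning
    p-q≈0 : ∀ e → coeff (p -ₚ q) e ≡ + 0
    p-q≈0 e = trans (coeff-++ p (-ₚ q) e)
      (trans (cong₂ _+ℤ_ (p≈q e) (coeff-neg q e)) (ℤP.+-inverseʳ (coeff q e)))

-- Products

infixl 6 _+ₘ_
infixl 7 _*ₜ_

_+ₘ_ : ∀ {N} → Mon N → Mon N → Mon N
_+ₘ_ = zipWith ℕ._+_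

+ₘ-comm : ∀ {N} (e f : Mon N) → e +ₘ f ≡ f +ₘ e
+ₘ-comm e f = Pointwise-≡⇒≡ (zipWith-comm ℕP.+-comm e f)

lookup-+ₘ : ∀ {N} (u v : Mon N) l → lookup (u +ₘ v) l ≡ lookup u l + lookup v l
lookup-+ₘ u v l = VecP.lookup-zipWith ℕ._+_ l u v

+ₘ-assoc : ∀ {N} (e f g : Mon N) → (e +ₘ f) +ₘ g ≡ e +ₘ (f +ₘ g)
+ₘ-assoc e f g = Pointwise-≡⇒≡ (zipWith-assoc ℕP.+-assoc e f g)

lookup-ext : ∀ {N} {u v : Vec ℕ N} → (∀ l → lookup u l ≡ lookup v l) → u ≡ v
lookup-ext {u = u} {v} u≗v =
  trans (sym (VecP.tabulate∘lookup u)) (trans (VecP.tabulate-cong u≗v) (VecP.tabulate∘lookup v))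

Term : ℕ → Set
Term N = ℤ × Mon N

_*ₜ_ : ∀ {N} → Term N → Term N → Term N
t *ₜ u = (proj₁ t *ℤ proj₁ u , proj₂ t +ₘ proj₂ u)

*ₜ-assoc : ∀ {N} (t u v : Term N) → (t *ₜ u) *ₜ v ≡ t *ₜ (u *ₜ v)
*ₜ-assoc t u v =
  cong₂ _,_ (ℤP.*-assoc (proj₁ t) (proj₁ u) (proj₁ v)) (+ₘ-assoc (proj₂ t) (proj₂ u) (proj₂ v))

module _ {N : ℕ} where

  coeff-*ₚ : ∀ (p q : Poly N) x → coeff (p *ₚ q) x ≡
             ∑ (λ t → ∑ (λ u → (proj₁ t *ℤ proj₁ u) *ℤ δ (proj₂ t +ₘ proj₂ u) x) q) p
  coeff-*ₚ p q x = trans (coeff≡linearExt (p *ₚ q) x)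
    (trans (∑-concatMap _ (λ t → map (t *ₜ_) q) p) (∑-cong (λ t → ∑-map _ (t *ₜ_) q) p))

  *ₚ-comm : ∀ (p q : Poly N) → p *ₚ q ≈ q *ₚ p
  *ₚ-comm p q x = begin
    coeff (p *ₚ q) x
      ≡⟨ coeff-*ₚ p q x ⟩
    ∑ (λ t → ∑ (λ u → (proj₁ t *ℤ proj₁ u) *ℤ δ (proj₂ t +ₘ proj₂ u) x) q) p
      ≡⟨ ∑-swap _ p q ⟩
    ∑ (λ u → ∑ (λ t → (proj₁ t *ℤ proj₁ u) *ℤ δ (proj₂ t +ₘ proj₂ u) x) p) q
      ≡⟨ ∑-cong (λ u → ∑-cong (λ t → cong₂ _*ℤ_ (ℤP.*-comm (proj₁ t) (proj₁ u))
                                                (cong (λ e → δ e x) (+ₘ-comm (proj₂ t) (proj₂ u)))) p) q ⟩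
    ∑ (λ u → ∑ (λ t → (proj₁ u *ℤ proj₁ t) *ℤ δ (proj₂ u +ₘ proj₂ t) x) p) q
      ≡⟨ sym (coeff-*ₚ q p x) ⟩
    coeff (q *ₚ p) x ∎
    where open ≡-Reasoning

  coeff-*ₚ≡linearExt : ∀ (p q : Poly N) x →
    coeff (p *ₚ q) x ≡ linearExt (λ e → ∑ (λ u → proj₁ u *ℤ δ (e +ₘ proj₂ u) x) q) p
  coeff-*ₚ≡linearExt p q x = trans (coeff-*ₚ p q x) (∑-cong (λ t →
    trans (∑-cong (λ u → ℤP.*-assoc (proj₁ t) (proj₁ u) _) q) (∑-*ˡ (proj₁ t) _ q)) p)

  *ₚ-congˡ : ∀ {p p′} (q : Poly N) → p ≈ p′ → p *ₚ q ≈ p′ *ₚ q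
  *ₚ-congˡ {p} {p′} q p≈p′ x = trans (coeff-*ₚ≡linearExt p q x)
    (trans (linearExt-cong _ {p} {p′} p≈p′) (sym (coeff-*ₚ≡linearExt p′ q x)))

  *ₚ-congʳ : ∀ (p : Poly N) {q q′} → q ≈ q′ → p *ₚ q ≈ p *ₚ q′
  *ₚ-congʳ p {q} {q′} q≈q′ x =
    trans (*ₚ-comm p q x) (trans (*ₚ-congˡ {q} {q′} p q≈q′ x) (*ₚ-comm q′ p x))

  *ₚ-assoc : ∀ (p q r : Poly N) → (p *ₚ q) *ₚ r ≡ p *ₚ (q *ₚ r)
  *ₚ-assoc p q r = trans (concatMap-concatMap (λ t → map (t *ₜ_) r) (λ t → map (t *ₜ_) q) p)
    (ListP.concatMap-cong (λ t → trans (ListP.concatMap-map (λ s → map (s *ₜ_) r) (t *ₜ_) q)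
       (sym (trans (ListP.map-concatMap (t *ₜ_) (λ u → map (u *ₜ_) r) q)
         (ListP.concatMap-cong (λ u → trans (sym (ListP.map-∘ r))
                                            (ListP.map-cong (λ v → sym (*ₜ-assoc t u v)) r)) q)))) p)
    where
    concatMap-concatMap : ∀ {A B C : Set} (f : B → List C) (g : A → List B) xs →
                          concatMap f (concatMap g xs) ≡ concatMap (concatMap f ∘ g) xs
    concatMap-concatMap f g []       = refl
    concatMap-concatMap f g (x ∷ xs) = trans (ListP.concatMap-++ f (g x) (concatMap g xs))
                                             (cong (concatMap f (g x) ++_) (concatMap-concatMap f g xs))

  *ₚ-isCommutativeSemigroup : IsCommutativeSemigroup (_≈_ {N}) _*ₚ_
  *ₚ-isCommutativeSemigroup = record
    { isSemigroup = record
      { isMagma = record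
        { isEquivalence = record { refl = λ _ → refl ; sym = λ p≈q e → sym (p≈q e)
                                 ; trans = λ p≈q q≈r e → trans (p≈q e) (q≈r e) }
        ; ∙-cong = λ {p} {p′} {q} {q′} p≈p′ q≈q′ e →
            trans (*ₚ-congˡ {p} {p′} q p≈p′ e) (*ₚ-congʳ p′ {q} {q′} q≈q′ e) }
      ; assoc = λ p q r e → cong (λ s → coeff s e) (*ₚ-assoc p q r) }
    ; comm = *ₚ-comm }

*ₚ-commutativeSemigroup : ℕ → CommutativeSemigroup _ _
*ₚ-commutativeSemigroup N = record { isCommutativeSemigroup = *ₚ-isCommutativeSemigroup {N} }

-- Divided differences

scale : ∀ {N} → ℤ → Term N → Term N
scale c t = (c *ℤ proj₁ t , proj₂ t)

coeff-scale : ∀ {N} c (p : Poly N) x → coeff (map (scale c) p) x ≡ c *ℤ coeff p x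
coeff-scale c p x = begin
  coeff (map (scale c) p) x                      ≡⟨ coeff≡linearExt (map (scale c) p) x ⟩
  linearExt (λ f → δ f x) (map (scale c) p)      ≡⟨ ∑-map _ (scale c) p ⟩
  ∑ (λ t → (c *ℤ proj₁ t) *ℤ δ (proj₂ t) x) p    ≡⟨ ∑-cong (λ t → ℤP.*-assoc c (proj₁ t) _) p ⟩
  ∑ (λ t → c *ℤ (proj₁ t *ℤ δ (proj₂ t) x)) p    ≡⟨ ∑-*ˡ c _ p ⟩
  c *ℤ linearExt (λ f → δ f x) p                 ≡⟨ cong (c *ℤ_) (sym (coeff≡linearExt p x)) ⟩
  c *ℤ coeff p x                                 ∎
  where open ≡-Reasoning

module _ {m : ℕ} where

  inject₁≢suc : (i : Fin m) → ¬ inject₁ i ≡ Fin.suc i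
  inject₁≢suc i eq = ℕP.<⇒≢ (ℕP.n<1+n (toℕ i)) (trans (sym (FinP.toℕ-inject₁ i)) (cong toℕ eq))

  exchange : Fin m → Mon (suc m) → ℕ → ℕ → Mon (suc m)
  exchange i e x y = setExp (setExp e (inject₁ i) x) (Fin.suc i) y

  lookup-exchange-inject₁ : ∀ i e x y → lookup (exchange i e x y) (inject₁ i) ≡ x
  lookup-exchange-inject₁ i e x y =
    trans (VecP.lookup∘updateAt′ (inject₁ i) (Fin.suc i) (inject₁≢suc i) (setExp e (inject₁ i) x))
          (VecP.lookup∘updateAt (inject₁ i) e)

  lookup-exchange-suc : ∀ i e x y → lookup (exchange i e x y) (Fin.suc i) ≡ y
  lookup-exchange-suc i e x y = VecP.lookup∘updateAt (Fin.suc i) (setExp e (inject₁ i) x)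

  lookup-exchange-other : ∀ i e x y l → ¬ l ≡ inject₁ i → ¬ l ≡ Fin.suc i →
                          lookup (exchange i e x y) l ≡ lookup e l
  lookup-exchange-other i e x y l l≢i l≢1+i =
    trans (VecP.lookup∘updateAt′ l (Fin.suc i) l≢1+i (setExp e (inject₁ i) x))
          (VecP.lookup∘updateAt′ l (inject₁ i) l≢i e)

  exchange-+ₘ : ∀ i (e h : Mon (suc m)) s x y →
                lookup e (inject₁ i) ≡ s → lookup e (Fin.suc i) ≡ s →
                exchange i (e +ₘ h) (s + x) (s + y) ≡ e +ₘ exchange i h x y
  exchange-+ₘ i e h s x y eᵢ≡s eᵢ₊₁≡s = lookup-ext pointwise
    where
    pointwise : ∀ l → lookup (exchange i (e +ₘ h) (s + x) (s + y)) l ≡ lookup (e +ₘ exchange i h x y) l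
    pointwise l with l FinP.≟ inject₁ i | l FinP.≟ Fin.suc i
    ... | yes refl | _ = trans (lookup-exchange-inject₁ i (e +ₘ h) (s + x) (s + y))
      (sym (trans (lookup-+ₘ e _ l) (cong₂ _+_ eᵢ≡s (lookup-exchange-inject₁ i h x y))))
    ... | no _ | yes refl = trans (lookup-exchange-suc i (e +ₘ h) (s + x) (s + y))
      (sym (trans (lookup-+ₘ e _ l) (cong₂ _+_ eᵢ₊₁≡s (lookup-exchange-suc i h x y))))
    ... | no l≢i | no l≢1+i = trans (lookup-exchange-other i (e +ₘ h) (s + x) (s + y) l l≢i l≢1+i)
      (trans (lookup-+ₘ e h l) (sym (trans (lookup-+ₘ e _ l)
        (cong (ℕ._+_ (lookup e l)) (lookup-exchange-other i h x y l l≢i l≢1+i)))))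

  ladder : Fin m → ℤ → Mon (suc m) → ℕ → ℕ → Poly (suc m)
  ladder i c e p q = map (λ j → (c , exchange i e (p ∸ suc j) (q + j))) (upTo (p ∸ q))

  -- ddMon with the two exponents it inspects passed as arguments, so that they can be rewritten
  ddMonAt : Fin m → ℤ → Mon (suc m) → ℕ → ℕ → Poly (suc m)
  ddMonAt i c e p q with q ≤? p
  ... | yes _ = ladder i c e p q
  ... | no _  = ladder i (-ℤ c) e q p

  ddMon≡ddMonAt : ∀ i c e → ddMon i c e ≡ ddMonAt i c e (lookup e (inject₁ i)) (lookup e (Fin.suc i))
  ddMon≡ddMonAt i c e with lookup e (inject₁ i) | lookup e (Fin.suc i)
  ... | p | q with q ≤? p
  ...   | yes _ = refl
  ...   | no _  = refl

  ladder-scale : ∀ i c d e p q → ladder i (c *ℤ d) e p q ≡ map (scale c) (ladder i d e p q)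
  ladder-scale i c d e p q = ListP.map-∘ (upTo (p ∸ q))

  ddMon-scale : ∀ i c e → ddMon i c e ≡ map (scale c) (ddMon i (+ 1) e)
  ddMon-scale i c e rewrite ddMon≡ddMonAt i c e | ddMon≡ddMonAt i (+ 1) e
    with lookup e (inject₁ i) | lookup e (Fin.suc i)
  ... | p | q with q ≤? p
  ...   | yes _ = trans (cong (λ c′ → ladder i c′ e p q) (sym (ℤP.*-identityʳ c)))
                        (ladder-scale i c (+ 1) e p q)
  ...   | no _  = trans (cong (λ c′ → ladder i c′ e q p)
                              (trans (cong -ℤ_ (sym (ℤP.*-identityʳ c))) (ℤP.neg-distribʳ-* c (+ 1))))
                        (ladder-scale i c (-ℤ + 1) e q p)

  coeff-∂ : ∀ i (p : Poly (suc m)) x → coeff (∂ i p) x ≡ linearExt (λ e → coeff (ddMon i (+ 1) e) x) p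
  coeff-∂ i p x = trans (coeff≡linearExt (∂ i p) x)
    (trans (∑-concatMap _ (λ t → ddMon i (proj₁ t) (proj₂ t)) p)
      (∑-cong (λ t → trans (sym (coeff≡linearExt (ddMon i (proj₁ t) (proj₂ t)) x))
                      (trans (cong (λ r → coeff r x) (ddMon-scale i (proj₁ t) (proj₂ t)))
                             (coeff-scale (proj₁ t) (ddMon i (+ 1) (proj₂ t)) x))) p))

  ∂-cong : ∀ i {p q : Poly (suc m)} → p ≈ q → ∂ i p ≈ ∂ i q
  ∂-cong i {p} {q} p≈q x =
    trans (coeff-∂ i p x) (trans (linearExt-cong _ {p} {q} p≈q) (sym (coeff-∂ i q x)))

  SymmetricAt : Fin m → Term (suc m) → Set
  SymmetricAt i t = lookup (proj₂ t) (inject₁ i) ≡ lookup (proj₂ t) (Fin.suc i)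

  *ₚ-symmetric : ∀ i (p q : Poly (suc m)) → All (SymmetricAt i) p → All (SymmetricAt i) q →
                 All (SymmetricAt i) (p *ₚ q)
  *ₚ-symmetric i []      q []            sym-q = []
  *ₚ-symmetric i (t ∷ p) q (sym-t ∷ sym-p) sym-q =
    AllP.++⁺ (AllP.map⁺ (All.map (λ {u} → symmetric-*ₜ u) sym-q)) (*ₚ-symmetric i p q sym-p sym-q)
    where
    symmetric-*ₜ : ∀ u → SymmetricAt i u → SymmetricAt i (t *ₜ u)
    symmetric-*ₜ u sym-u = trans (lookup-+ₘ (proj₂ t) (proj₂ u) (inject₁ i))
      (trans (cong₂ _+_ sym-t sym-u) (sym (lookup-+ₘ (proj₂ t) (proj₂ u) (Fin.suc i))))

  ladder-*ₜ : ∀ i c d (e h : Mon (suc m)) s p q → lookup e (inject₁ i) ≡ s → lookup e (Fin.suc i) ≡ s →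
              ladder i (c *ℤ d) (e +ₘ h) (s + p) (s + q) ≡ map ((c , e) *ₜ_) (ladder i d h p q)
  ladder-*ₜ i c d e h s p q eᵢ≡s eᵢ₊₁≡s rewrite ℕP.[m+n]∸[m+o]≡n∸o s p q =
    trans (ListP.map-cong-local (AllP.applyUpTo⁺₁ id (p ∸ q) (cong (c *ℤ d ,_) ∘ shifted)))
          (ListP.map-∘ (upTo (p ∸ q)))
    where
    shifted : ∀ {j} → j < p ∸ q → exchange i (e +ₘ h) (s + p ∸ suc j) (s + q + j)
                                   ≡ e +ₘ exchange i h (p ∸ suc j) (q + j)
    shifted {j} j<p∸q = trans
      (cong₂ (exchange i (e +ₘ h)) (ℕP.+-∸-assoc s (ℕP.≤-trans j<p∸q (ℕP.m∸n≤m p q)))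
                                   (ℕP.+-assoc s q j))
      (exchange-+ₘ i e h s (p ∸ suc j) (q + j) eᵢ≡s eᵢ₊₁≡s)

  ddMonAt-*ₜ : ∀ i c d (e h : Mon (suc m)) s p q → lookup e (inject₁ i) ≡ s → lookup e (Fin.suc i) ≡ s →
               ddMonAt i (c *ℤ d) (e +ₘ h) (s + p) (s + q) ≡ map ((c , e) *ₜ_) (ddMonAt i d h p q)
  ddMonAt-*ₜ i c d e h s p q eᵢ≡s eᵢ₊₁≡s with q ≤? p | s + q ≤? s + p
  ... | yes _   | yes _     = ladder-*ₜ i c d e h s p q eᵢ≡s eᵢ₊₁≡s
  ... | no _    | no _      =
    trans (cong (λ c′ → ladder i c′ (e +ₘ h) (s + q) (s + p)) (ℤP.neg-distribʳ-* c d))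
                                    (ladder-*ₜ i c (-ℤ d) e h s q p eᵢ≡s eᵢ₊₁≡s)
  ... | yes q≤p | no s+q≰s+p = contradiction (ℕP.+-monoʳ-≤ s q≤p) s+q≰s+p
  ... | no q≰p  | yes s+q≤s+p = contradiction (ℕP.+-cancelˡ-≤ s q p s+q≤s+p) q≰p

  ddMon-*ₜ : ∀ i (t : Term (suc m)) d h → SymmetricAt i t →
             ddMon i (proj₁ t *ℤ d) (proj₂ t +ₘ h) ≡ map (t *ₜ_) (ddMon i d h)
  ddMon-*ₜ i (c , e) d h eᵢ≡eᵢ₊₁ = begin
    ddMon i (c *ℤ d) (e +ₘ h)
      ≡⟨ ddMon≡ddMonAt i (c *ℤ d) (e +ₘ h) ⟩
    ddMonAt i (c *ℤ d) (e +ₘ h) (lookup (e +ₘ h) (inject₁ i)) (lookup (e +ₘ h) (Fin.suc i))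
      ≡⟨ cong₂ (ddMonAt i (c *ℤ d) (e +ₘ h)) (lookup-+ₘ e h (inject₁ i))
               (trans (lookup-+ₘ e h (Fin.suc i)) (cong (ℕ._+ lookup h (Fin.suc i)) (sym eᵢ≡eᵢ₊₁))) ⟩
    ddMonAt i (c *ℤ d) (e +ₘ h) (s + lookup h (inject₁ i)) (s + lookup h (Fin.suc i))
      ≡⟨ ddMonAt-*ₜ i c d e h s _ _ refl (sym eᵢ≡eᵢ₊₁) ⟩
    map ((c , e) *ₜ_) (ddMonAt i d h (lookup h (inject₁ i)) (lookup h (Fin.suc i)))
      ≡⟨ cong (map ((c , e) *ₜ_)) (sym (ddMon≡ddMonAt i d h)) ⟩
    map ((c , e) *ₜ_) (ddMon i d h) ∎
    where
    open ≡-Reasoning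
    s = lookup e (inject₁ i)

  ∂-*ₚ-symmetric : ∀ i (f g : Poly (suc m)) → All (SymmetricAt i) f → ∂ i (f *ₚ g) ≡ f *ₚ ∂ i g
  ∂-*ₚ-symmetric i []      g []            = refl
  ∂-*ₚ-symmetric i (t ∷ f) g (sym-t ∷ sym-f) =
    trans (ListP.concatMap-++ _ (map (t *ₜ_) g) (f *ₚ g))
          (cong₂ _++_ (∂-map g) (∂-*ₚ-symmetric i f g sym-f))
    where
    ∂-map : ∀ g → ∂ i (map (t *ₜ_) g) ≡ map (t *ₜ_) (∂ i g)
    ∂-map []      = refl
    ∂-map (u ∷ g) = trans (cong₂ _++_ (ddMon-*ₜ i t (proj₁ u) (proj₂ u) sym-t) (∂-map g))
                          (sym (ListP.map-++ (t *ₜ_) (ddMon i (proj₁ u) (proj₂ u)) (∂ i g)))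

π : ∀ {m} → Fin m → Poly (suc m) → Poly (suc m)
π i f = ∂ i ((1ₚ -ₚ var (Fin.suc i)) *ₚ f)

module _ {m : ℕ} (i : Fin m) where
  open CommutativeSemigroup (*ₚ-commutativeSemigroup (suc m)) using (setoid)
  open CommutativeSemigroupProperties (*ₚ-commutativeSemigroup (suc m)) using (x∙yz≈y∙xz)
  open import Relation.Binary.Reasoning.Setoid setoid

  π-cong : ∀ {f g} → f ≈ g → π i f ≈ π i g
  π-cong {f} {g} f≈g = ∂-cong i {X *ₚ f} {X *ₚ g} (*ₚ-congʳ X {f} {g} f≈g)
    where X = 1ₚ -ₚ var (Fin.suc i)

  π-symmetric-factor : ∀ C f → All (SymmetricAt i) C → π i (C *ₚ f) ≈ C *ₚ π i f
  π-symmetric-factor C f C-symmetric = begin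
    ∂ i (X *ₚ (C *ₚ f))  ≈⟨ ∂-cong i {X *ₚ (C *ₚ f)} {C *ₚ (X *ₚ f)} (x∙yz≈y∙xz X C f) ⟩
    ∂ i (C *ₚ (X *ₚ f))  ≡⟨ ∂-*ₚ-symmetric i C (X *ₚ f) C-symmetric ⟩
    C *ₚ ∂ i (X *ₚ f)    ∎
    where X = 1ₚ -ₚ var (Fin.suc i)

-- Renaming variables

sum-δ : ∀ {N} (j : Fin N) (g : Fin N → ℕ) →
        sum (map (λ j′ → if does (j FinP.≟ j′) then g j′ else 0) (allFin N)) ≡ g j
sum-δ j g = trans (cong sum (ListP.map-tabulate id (λ j′ → if does (j FinP.≟ j′) then g j′ else 0)))
                  (sum-tabulate-δ j g)
  where
  sum-tabulate-zero : ∀ K → sum (List.tabulate {n = K} (λ _ → 0)) ≡ 0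
  sum-tabulate-zero zero    = refl
  sum-tabulate-zero (suc K) = sum-tabulate-zero K
  sum-tabulate-δ : ∀ {K} (j : Fin K) (g : Fin K → ℕ) →
                   sum (List.tabulate (λ j′ → if does (j FinP.≟ j′) then g j′ else 0)) ≡ g j
  sum-tabulate-δ {suc K} Fin.zero    g =
    trans (cong (ℕ._+_ (g Fin.zero)) (sum-tabulate-zero K)) (ℕP.+-identityʳ _)
  sum-tabulate-δ {suc K} (Fin.suc j) g = sum-tabulate-δ j (g ∘ Fin.suc)

unitMon : ∀ {N} → Fin N → Mon N
unitMon j = tabulate λ l → if does (l FinP.≟ j) then 1 else 0

module _ {N M : ℕ} (σ : Fin N → Fin M) where

  indicator : Mon N → Fin M → Fin N → ℕ
  indicator e l j = if does (l FinP.≟ σ j) then lookup e j else 0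

  lookup-renameMon : ∀ e l → lookup (renameMon σ e) l ≡ sum (map (indicator e l) (allFin N))
  lookup-renameMon e l = trans (lookup-foldr (map rowOf (allFin N)))
    (trans (cong sum (sym (ListP.map-∘ (allFin N))))
           (cong sum (ListP.map-cong (λ j → VecP.lookup∘tabulate (λ l′ → indicator e l′ j) l) (allFin N))))
    where
    rowOf : Fin N → Vec ℕ M
    rowOf j = tabulate λ l′ → indicator e l′ j
    lookup-foldr : ∀ (vs : List (Vec ℕ M)) →
                   lookup (foldr _+ₘ_ zeroMon vs) l ≡ sum (map (λ v → lookup v l) vs)
    lookup-foldr []       = VecP.lookup-replicate l 0
    lookup-foldr (v ∷ vs) = trans (lookup-+ₘ v _ l) (cong (ℕ._+_ (lookup v l)) (lookup-foldr vs))

  lookup-renameMon-outside : ∀ e l → (∀ j → ¬ σ j ≡ l) → lookup (renameMon σ e) l ≡ 0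
  lookup-renameMon-outside e l l∉σ =
    trans (lookup-renameMon e l) (trans (cong sum (ListP.map-cong vanish (allFin N))) (sum-zeros (allFin N)))
    where
    vanish : ∀ j → indicator e l j ≡ 0
    vanish j with l FinP.≟ σ j
    ... | yes l≡σj = contradiction (sym l≡σj) (l∉σ j)
    ... | no _     = refl
    sum-zeros : ∀ (js : List (Fin N)) → sum (map (λ _ → 0) js) ≡ 0
    sum-zeros []       = refl
    sum-zeros (j ∷ js) = sum-zeros js

  module _ (σ-injective : Injective _≡_ _≡_ σ) where

    lookup-renameMon-image : ∀ e j → lookup (renameMon σ e) (σ j) ≡ lookup e j
    lookup-renameMon-image e j =
      trans (lookup-renameMon e (σ j)) (trans (cong sum (ListP.map-cong delta (allFin N))) (sum-δ j (lookup e)))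
      where
      delta : ∀ j′ → indicator e (σ j) j′ ≡ (if does (j FinP.≟ j′) then lookup e j′ else 0)
      delta j′ with σ j FinP.≟ σ j′ | j FinP.≟ j′
      ... | yes _       | yes _    = refl
      ... | no _        | no _     = refl
      ... | yes σj≡σj′  | no j≢j′  = contradiction (σ-injective σj≡σj′) j≢j′
      ... | no σj≢σj′   | yes refl = contradiction refl σj≢σj′

    renameMon-ext : ∀ e (v : Mon M) → (∀ j → lookup v (σ j) ≡ lookup e j) →
                    (∀ l → (∀ j → ¬ σ j ≡ l) → lookup v l ≡ 0) → renameMon σ e ≡ v
    renameMon-ext e v on-image off-image = lookup-ext pointwise
      where
      pointwise : ∀ l → lookup (renameMon σ e) l ≡ lookup v l
      pointwise l with FinP.any? (λ j → σ j FinP.≟ l)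
      ... | yes (j , refl) = trans (lookup-renameMon-image e j) (sym (on-image j))
      ... | no l∉σ         = trans (lookup-renameMon-outside e l (λ j σj≡l → l∉σ (j , σj≡l)))
                                   (sym (off-image l (λ j σj≡l → l∉σ (j , σj≡l))))

    renameMon-+ₘ : ∀ e f → renameMon σ (e +ₘ f) ≡ renameMon σ e +ₘ renameMon σ f
    renameMon-+ₘ e f = renameMon-ext (e +ₘ f) _
      (λ j → trans (lookup-+ₘ (renameMon σ e) _ (σ j))
               (trans (cong₂ _+_ (lookup-renameMon-image e j) (lookup-renameMon-image f j))
                      (sym (lookup-+ₘ e f j))))
      (λ l l∉σ → trans (lookup-+ₘ (renameMon σ e) _ l)
                   (cong₂ _+_ (lookup-renameMon-outside e l l∉σ) (lookup-renameMon-outside f l l∉σ)))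

    renameMon-zeroMon : renameMon σ zeroMon ≡ zeroMon
    renameMon-zeroMon = renameMon-ext zeroMon zeroMon
      (λ j → trans (VecP.lookup-replicate (σ j) 0) (sym (VecP.lookup-replicate j 0)))
      (λ l _ → VecP.lookup-replicate l 0)

    renameMon-unitMon : ∀ j → renameMon σ (unitMon j) ≡ unitMon (σ j)
    renameMon-unitMon j = renameMon-ext (unitMon j) (unitMon (σ j)) on-image off-image
      where
      on-image : ∀ j′ → lookup (unitMon (σ j)) (σ j′) ≡ lookup (unitMon j) j′
      on-image j′ rewrite VecP.lookup∘tabulate (λ l → if does (l FinP.≟ σ j) then 1 else 0) (σ j′)
                        | VecP.lookup∘tabulate (λ l → if does (l FinP.≟ j) then 1 else 0) j′
        with σ j′ FinP.≟ σ j | j′ FinP.≟ j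
      ... | yes _       | yes _    = refl
      ... | no _        | no _     = refl
      ... | yes σj′≡σj  | no j′≢j  = contradiction (σ-injective σj′≡σj) j′≢j
      ... | no σj′≢σj   | yes refl = contradiction refl σj′≢σj
      off-image : ∀ l → (∀ j′ → ¬ σ j′ ≡ l) → lookup (unitMon (σ j)) l ≡ 0
      off-image l l∉σ rewrite VecP.lookup∘tabulate (λ l → if does (l FinP.≟ σ j) then 1 else 0) l
        with l FinP.≟ σ j
      ... | yes l≡σj = contradiction (sym l≡σj) (l∉σ j)
      ... | no _     = refl

    rename-*ₚ : ∀ (p q : Poly N) → rename σ (p *ₚ q) ≡ rename σ p *ₚ rename σ q
    rename-*ₚ p q = trans (ListP.map-concatMap renameₜ (λ t → map (t *ₜ_) q) p)
      (sym (trans (ListP.concatMap-map (λ t → map (t *ₜ_) (rename σ q)) renameₜ p)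
        (ListP.concatMap-cong (λ t → trans (sym (ListP.map-∘ q))
          (trans (ListP.map-cong (λ u → cong (proj₁ t *ℤ proj₁ u ,_)
                                             (sym (renameMon-+ₘ (proj₂ t) (proj₂ u)))) q)
                 (ListP.map-∘ q))) p)))
      where
      renameₜ : Term N → Term M
      renameₜ t = (proj₁ t , renameMon σ (proj₂ t))

    rename-1-x : ∀ j → rename σ (1ₚ -ₚ var j) ≡ 1ₚ -ₚ var (σ j)
    rename-1-x j = cong₂ (λ e f → (+ 1 , e) ∷ (-ℤ + 1 , f) ∷ []) renameMon-zeroMon (renameMon-unitMon j)

rename-symmetric : ∀ {N m} (σ : Fin N → Fin (suc m)) (i : Fin m) →
                   (∀ j → ¬ σ j ≡ inject₁ i) → (∀ j → ¬ σ j ≡ Fin.suc i) →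
                   ∀ p → All (SymmetricAt i) (rename σ p)
rename-symmetric σ i i∉σ 1+i∉σ []            = []
rename-symmetric σ i i∉σ 1+i∉σ ((c , e) ∷ p) =
  trans (lookup-renameMon-outside σ e _ i∉σ) (sym (lookup-renameMon-outside σ e _ 1+i∉σ))
  ∷ rename-symmetric σ i i∉σ 1+i∉σ p

module AdjacentPair {n m : ℕ} (σ : Fin (suc n) → Fin (suc m)) (σ-injective : Injective _≡_ _≡_ σ)
                    {i : Fin n} {i′ : Fin m}
                    (σ-inject₁ : σ (inject₁ i) ≡ inject₁ i′) (σ-suc : σ (Fin.suc i) ≡ Fin.suc i′) where

  private
    renameₜ : Term (suc n) → Term (suc m)
    renameₜ t = (proj₁ t , renameMon σ (proj₂ t))

  renameMon-exchange : ∀ e x y → renameMon σ (exchange i e x y) ≡ exchange i′ (renameMon σ e) x y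
  renameMon-exchange e x y =
    renameMon-ext σ σ-injective (exchange i e x y) (exchange i′ (renameMon σ e) x y) on-image off-image
    where
    on-image : ∀ j → lookup (exchange i′ (renameMon σ e) x y) (σ j) ≡ lookup (exchange i e x y) j
    on-image j with j FinP.≟ inject₁ i | j FinP.≟ Fin.suc i
    ... | yes refl | _ = trans (cong (lookup (exchange i′ (renameMon σ e) x y)) σ-inject₁)
      (trans (lookup-exchange-inject₁ i′ (renameMon σ e) x y) (sym (lookup-exchange-inject₁ i e x y)))
    ... | no _ | yes refl = trans (cong (lookup (exchange i′ (renameMon σ e) x y)) σ-suc)
      (trans (lookup-exchange-suc i′ (renameMon σ e) x y) (sym (lookup-exchange-suc i e x y)))
    ... | no j≢i | no j≢1+i = trans (lookup-exchange-other i′ (renameMon σ e) x y (σ j)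
          (λ σj≡i′ → j≢i (σ-injective (trans σj≡i′ (sym σ-inject₁))))
          (λ σj≡1+i′ → j≢1+i (σ-injective (trans σj≡1+i′ (sym σ-suc)))))
      (trans (lookup-renameMon-image σ σ-injective e j) (sym (lookup-exchange-other i e x y j j≢i j≢1+i)))
    off-image : ∀ l → (∀ j → ¬ σ j ≡ l) → lookup (exchange i′ (renameMon σ e) x y) l ≡ 0
    off-image l l∉σ = trans (lookup-exchange-other i′ (renameMon σ e) x y l
        (λ l≡i′ → l∉σ (inject₁ i) (trans σ-inject₁ (sym l≡i′)))
        (λ l≡1+i′ → l∉σ (Fin.suc i) (trans σ-suc (sym l≡1+i′))))
      (lookup-renameMon-outside σ e l l∉σ)

  ladder-rename : ∀ c e p q → map renameₜ (ladder i c e p q) ≡ ladder i′ c (renameMon σ e) p q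
  ladder-rename c e p q = trans (sym (ListP.map-∘ (upTo (p ∸ q))))
    (ListP.map-cong (λ j → cong (c ,_) (renameMon-exchange e (p ∸ suc j) (q + j))) (upTo (p ∸ q)))

  ddMonAt-rename : ∀ c e p q → map renameₜ (ddMonAt i c e p q) ≡ ddMonAt i′ c (renameMon σ e) p q
  ddMonAt-rename c e p q with q ≤? p
  ... | yes _ = ladder-rename c e p q
  ... | no _  = ladder-rename (-ℤ c) e q p

  ddMon-rename : ∀ c e → map renameₜ (ddMon i c e) ≡ ddMon i′ c (renameMon σ e)
  ddMon-rename c e = begin
    map renameₜ (ddMon i c e)
      ≡⟨ cong (map renameₜ) (ddMon≡ddMonAt i c e) ⟩
    map renameₜ (ddMonAt i c e (lookup e (inject₁ i)) (lookup e (Fin.suc i)))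
      ≡⟨ ddMonAt-rename c e (lookup e (inject₁ i)) (lookup e (Fin.suc i)) ⟩
    ddMonAt i′ c (renameMon σ e) (lookup e (inject₁ i)) (lookup e (Fin.suc i))
      ≡⟨ sym (cong₂ (ddMonAt i′ c (renameMon σ e)) (lookup-image σ-inject₁) (lookup-image σ-suc)) ⟩
    ddMonAt i′ c (renameMon σ e) (lookup (renameMon σ e) (inject₁ i′)) (lookup (renameMon σ e) (Fin.suc i′))
      ≡⟨ sym (ddMon≡ddMonAt i′ c (renameMon σ e)) ⟩
    ddMon i′ c (renameMon σ e) ∎
    where
    open ≡-Reasoning
    lookup-image : ∀ {j j′} → σ j ≡ j′ → lookup (renameMon σ e) j′ ≡ lookup e j
    lookup-image refl = lookup-renameMon-image σ σ-injective e _

  rename-∂ : ∀ p → rename σ (∂ i p) ≡ ∂ i′ (rename σ p)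
  rename-∂ p = trans (ListP.map-concatMap renameₜ (λ t → ddMon i (proj₁ t) (proj₂ t)) p)
    (sym (trans (ListP.concatMap-map (λ t → ddMon i′ (proj₁ t) (proj₂ t)) renameₜ p)
                (ListP.concatMap-cong (λ t → sym (ddMon-rename (proj₁ t) (proj₂ t))) p)))

  rename-π : ∀ f → rename σ (π i f) ≡ π i′ (rename σ f)
  rename-π f = begin
    rename σ (∂ i (X *ₚ f))
      ≡⟨ rename-∂ (X *ₚ f) ⟩
    ∂ i′ (rename σ (X *ₚ f))
      ≡⟨ cong (∂ i′) (rename-*ₚ σ σ-injective X f) ⟩
    ∂ i′ (rename σ X *ₚ rename σ f)
      ≡⟨ cong (λ Y → ∂ i′ (Y *ₚ rename σ f)) (rename-1-x σ σ-injective (Fin.suc i)) ⟩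
    ∂ i′ ((1ₚ -ₚ var (σ (Fin.suc i))) *ₚ rename σ f)
      ≡⟨ cong (λ j → ∂ i′ ((1ₚ -ₚ var j) *ₚ rename σ f)) σ-suc ⟩
    π i′ (rename σ f) ∎
    where
    open ≡-Reasoning
    X = 1ₚ -ₚ var (Fin.suc i)

-- First ascents

IsShift : ∀ {a N} → ℕ → (Fin a → Fin N) → Set
IsShift c σ = ∀ j → toℕ (σ j) ≡ c + toℕ j

module _ {a N c} {σ : Fin a → Fin N} (σ-shift : IsShift c σ) where

  shift-injective : Injective _≡_ _≡_ σ
  shift-injective {x} {y} σx≡σy = FinP.toℕ-injective
    (ℕP.+-cancelˡ-≡ c (toℕ x) (toℕ y) (trans (sym (σ-shift x)) (trans (cong toℕ σx≡σy) (σ-shift y))))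

  shift-preimage : ∀ l → c ≤ toℕ l → toℕ l < c + a → Σ (Fin a) λ j → σ j ≡ l
  shift-preimage l c≤l l<c+a = j , FinP.toℕ-injective (begin
    toℕ (σ j)          ≡⟨ σ-shift j ⟩
    c + toℕ j          ≡⟨ cong (ℕ._+_ c) (FinP.toℕ-fromℕ< l∸c<a) ⟩
    c + (toℕ l ∸ c)    ≡⟨ ℕP.m+[n∸m]≡n c≤l ⟩
    toℕ l              ∎)
    where
    open ≡-Reasoning
    l∸c<a : toℕ l ∸ c < a
    l∸c<a = ℕP.+-cancelˡ-< c (toℕ l ∸ c) a (subst (_< c + a) (sym (ℕP.m+[n∸m]≡n c≤l)) l<c+a)
    j = Fin.fromℕ< l∸c<a

shift-head : ∀ {a N c} {σ : Fin (suc a) → Fin N} → IsShift c σ → toℕ (σ Fin.zero) ≡ c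
shift-head {c = c} σ-shift = trans (σ-shift Fin.zero) (ℕP.+-identityʳ c)

shift-tail : ∀ {a N c} {σ : Fin (suc a) → Fin N} → IsShift c σ → IsShift (suc c) (σ ∘ Fin.suc)
shift-tail {c = c} σ-shift x = trans (σ-shift (Fin.suc x)) (ℕP.+-suc c (toℕ x))

value : ∀ {N} → Permutation′ N → Fin N → ℕ
value w j = toℕ (w ⟨$⟩ʳ j)

IsAscent : ∀ {m} → Permutation′ (suc m) → Fin m → Set
IsAscent w i = value w (inject₁ i) < value w (Fin.suc i)

DecreasingUpTo : ∀ {N} → Permutation′ N → ℕ → Set
DecreasingUpTo {N} w p = ∀ (a b : Fin N) → toℕ b ≡ suc (toℕ a) → toℕ a < p → value w b ≤ value w a

module _ {m : ℕ} (w : Permutation′ (suc m)) where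

  decreasing⇒¬ascent : ∀ {p} → DecreasingUpTo w p → ∀ j → toℕ j < p → ¬ IsAscent w j
  decreasing⇒¬ascent {p} w↓ j j<p ascent = ℕP.<⇒≱ ascent (w↓ (inject₁ j) (Fin.suc j)
    (cong suc (sym (FinP.toℕ-inject₁ j))) (subst (_< p) (sym (FinP.toℕ-inject₁ j)) j<p))

  ¬ascent⇒decreasing : ∀ {p} → (∀ j → toℕ j < p → ¬ IsAscent w j) → DecreasingUpTo w p
  ¬ascent⇒decreasing {p} no-ascent a b b≡1+a a<p =
    subst₂ (λ x y → value w y ≤ value w x) inject₁j≡a suc-j≡b
      (ℕP.≮⇒≥ (no-ascent j (subst (_< p) (sym toℕ-j) a<p)))
    where
    a<m : toℕ a < m
    a<m = ℕP.≤-pred (subst (_< suc m) b≡1+a (FinP.toℕ<n b))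
    j = Fin.fromℕ< a<m
    toℕ-j : toℕ j ≡ toℕ a
    toℕ-j = FinP.toℕ-fromℕ< a<m
    inject₁j≡a : inject₁ j ≡ a
    inject₁j≡a = FinP.toℕ-injective (trans (FinP.toℕ-inject₁ j) toℕ-j)
    suc-j≡b : Fin.suc j ≡ b
    suc-j≡b = FinP.toℕ-injective (trans (cong suc toℕ-j) (sym b≡1+a))

  private
    -- The search function local to firstAscent cannot be named; it is recovered as the solution
    -- of the meta `_` forced by the equation below.
    recover-search : Σ (List (Fin m) → Ascent w) (λ search → search (allFin m) ≡ firstAscent w)
    recover-search = search , search-allFin
      where
      search : List (Fin m) → Ascent w
      search = _
      search-allFin : search (allFin m) ≡ firstAscent w
      search-allFin with allFin m
      ... | is = refl

    search : List (Fin m) → Ascent w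
    search = proj₁ recover-search

    search-allFin : search (allFin m) ≡ firstAscent w
    search-allFin = proj₂ recover-search

    at-injective : ∀ {i j} → _≡_ {A = Ascent w} (at i) (at j) → i ≡ j
    at-injective refl = refl

    search-at : ∀ r c (f : Fin r → Fin m) → IsShift c f → ∀ i →
                search (List.tabulate f) ≡ at i →
                IsAscent w i × (∀ j → c ≤ toℕ j → toℕ j < toℕ i → ¬ IsAscent w j)
    search-at zero    c f f-shift i ()
    search-at (suc r) c f f-shift i found
      with (w ⟨$⟩ʳ inject₁ (f Fin.zero)) Fin.<? (w ⟨$⟩ʳ Fin.suc (f Fin.zero))
    ... | yes ascent with at-injective {f Fin.zero} {i} found
    ...   | refl = ascent , λ j c≤j j<i →
                     contradiction c≤j (ℕP.<⇒≱ (subst (toℕ j <_) (shift-head f-shift) j<i))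
    search-at (suc r) c f f-shift i found | no ¬ascent
      with search-at r (suc c) (f ∘ Fin.suc) (shift-tail f-shift) i found
    ... | ascent , before = ascent , λ j c≤j j<i → earlier j c≤j j<i (toℕ j ℕ.≟ c)
      where
      earlier : ∀ j → c ≤ toℕ j → toℕ j < toℕ i → Dec (toℕ j ≡ c) → ¬ IsAscent w j
      earlier j c≤j j<i (yes j≡c) =
        subst (¬_ ∘ IsAscent w) (FinP.toℕ-injective (trans (shift-head f-shift) (sym j≡c))) ¬ascent
      earlier j c≤j j<i (no j≢c)  = before j (ℕP.≤∧≢⇒< c≤j (j≢c ∘ sym)) j<i

    search-none : ∀ r c (f : Fin r → Fin m) → IsShift c f →
                  search (List.tabulate f) ≡ none →
                  ∀ j → c ≤ toℕ j → toℕ j < c + r → ¬ IsAscent w j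
    search-none zero    c f f-shift _ j c≤j j<c+0 =
      contradiction c≤j (ℕP.<⇒≱ (subst (toℕ j <_) (ℕP.+-identityʳ c) j<c+0))
    search-none (suc r) c f f-shift found j c≤j j<c+1+r
      with (w ⟨$⟩ʳ inject₁ (f Fin.zero)) Fin.<? (w ⟨$⟩ʳ Fin.suc (f Fin.zero))
    ... | yes _ = contradiction found λ ()
    ... | no ¬ascent with toℕ j ℕ.≟ c
    ...   | yes j≡c =
      subst (¬_ ∘ IsAscent w) (FinP.toℕ-injective (trans (shift-head f-shift) (sym j≡c))) ¬ascent
    ...   | no j≢c  = search-none r (suc c) (f ∘ Fin.suc) (shift-tail f-shift) found j
                        (ℕP.≤∧≢⇒< c≤j (j≢c ∘ sym)) (subst (toℕ j <_) (ℕP.+-suc c r) j<c+1+r)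

  firstAscent-at : ∀ {i} → firstAscent w ≡ at i → IsAscent w i × DecreasingUpTo w (toℕ i)
  firstAscent-at {i} found with search-at m 0 id (λ _ → refl) i (trans search-allFin found)
  ... | ascent , before = ascent , ¬ascent⇒decreasing (λ j → before j z≤n)

  firstAscent-none : firstAscent w ≡ none → DecreasingUpTo w (suc m)
  firstAscent-none found = ¬ascent⇒decreasing λ j _ →
    search-none m 0 id (λ _ → refl) (trans search-allFin found) j z≤n (FinP.toℕ<n j)

  firstAscent≡at : ∀ {i} → IsAscent w i → DecreasingUpTo w (toℕ i) → firstAscent w ≡ at i
  firstAscent≡at {i} ascent w↓ with firstAscent w in found
  ... | none =
    contradiction ascent (decreasing⇒¬ascent (firstAscent-none found) i (ℕP.m<n⇒m<1+n (FinP.toℕ<n i)))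
  ... | at j with firstAscent-at found | ℕP.<-cmp (toℕ j) (toℕ i)
  ...   | ascent′ , _   | tri< j<i _ _ = contradiction ascent′ (decreasing⇒¬ascent w↓ j j<i)
  ...   | _             | tri≈ _ j≡i _ = cong at (FinP.toℕ-injective j≡i)
  ...   | _ , w↓′       | tri> _ _ i<j = contradiction ascent (decreasing⇒¬ascent w↓′ i i<j)

  firstAscent≡none : DecreasingUpTo w (suc m) → firstAscent w ≡ none
  firstAscent≡none w↓ with firstAscent w in found
  ... | none = refl
  ... | at j = contradiction (proj₁ (firstAscent-at found))
                             (decreasing⇒¬ascent w↓ j (ℕP.m<n⇒m<1+n (FinP.toℕ<n j)))

-- Length

swapNext : ℕ → ℕ → ℕ
swapNext t x with x ℕ.≟ t
... | yes _ = suc t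
... | no _ with x ℕ.≟ suc t
...   | yes _ = t
...   | no _  = x

data SwapNextView (t : ℕ) : ℕ → ℕ → Set where
  left  : SwapNextView t t (suc t)
  right : SwapNextView t (suc t) t
  fixed : ∀ {x} → ¬ x ≡ t → ¬ x ≡ suc t → SwapNextView t x x

swapNext-view : ∀ t x → SwapNextView t x (swapNext t x)
swapNext-view t x with x ℕ.≟ t
... | yes refl = left
... | no x≢t with x ℕ.≟ suc t
...   | yes refl = right
...   | no x≢1+t = fixed x≢t x≢1+t

swapNext-left : ∀ t → swapNext t t ≡ suc t
swapNext-left t with swapNext t t | swapNext-view t t
... | _ | left          = refl
... | _ | fixed t≢t _  = contradiction refl t≢t

swapNext-right : ∀ t → swapNext t (suc t) ≡ t
swapNext-right t with swapNext t (suc t) | swapNext-view t (suc t)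
... | _ | right           = refl
... | _ | fixed _ 1+t≢1+t = contradiction refl 1+t≢1+t

swapNext-fixed : ∀ t x → ¬ x ≡ t → ¬ x ≡ suc t → swapNext t x ≡ x
swapNext-fixed t x x≢t x≢1+t with swapNext t x | swapNext-view t x
... | _ | left      = contradiction refl x≢t
... | _ | right     = contradiction refl x≢1+t
... | _ | fixed _ _ = refl

swapNext-involutive : ∀ t x → swapNext t (swapNext t x) ≡ x
swapNext-involutive t x with swapNext t x | swapNext-view t x
... | _ | left              = swapNext-right t
... | _ | right             = swapNext-left t
... | _ | fixed x≢t x≢1+t   = swapNext-fixed t x x≢t x≢1+t

swapNext-+ : ∀ k t x → swapNext (k + t) (k + x) ≡ k + swapNext t x
swapNext-+ k t x with swapNext t x | swapNext-view t x
... | _ | left  = trans (swapNext-left (k + t)) (sym (ℕP.+-suc k t))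
... | _ | right = trans (cong (swapNext (k + t)) (ℕP.+-suc k t)) (swapNext-right (k + t))
... | _ | fixed x≢t x≢1+t = swapNext-fixed (k + t) (k + x) (x≢t ∘ ℕP.+-cancelˡ-≡ k x t)
  (λ k+x≡1+k+t → x≢1+t (ℕP.+-cancelˡ-≡ k x (suc t) (trans k+x≡1+k+t (sym (ℕP.+-suc k t)))))

swapNext-monotone : ∀ t x y → x < y → ¬ (x ≡ t × y ≡ suc t) → swapNext t x < swapNext t y
swapNext-monotone t x y x<y not-swapped
  with swapNext t x | swapNext-view t x | swapNext t y | swapNext-view t y
... | _ | left         | _ | left         = contradiction x<y (ℕP.<-irrefl refl)
... | _ | left         | _ | right        = contradiction (refl , refl) not-swapped
... | _ | left         | _ | fixed _ y≢1+t = ℕP.≤∧≢⇒< x<y (y≢1+t ∘ sym)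
... | _ | right        | _ | left         = contradiction x<y (ℕP.<-asym (ℕP.n<1+n t))
... | _ | right        | _ | right        = contradiction x<y (ℕP.<-irrefl refl)
... | _ | right        | _ | fixed _ _    = ℕP.<-trans (ℕP.n<1+n t) x<y
... | _ | fixed _ _    | _ | left         = ℕP.<-trans x<y (ℕP.n<1+n t)
... | _ | fixed x≢t _  | _ | right        = ℕP.≤∧≢⇒< (ℕP.≤-pred x<y) x≢t
... | _ | fixed _ _    | _ | fixed _ _    = x<y

τ : ∀ {m} → Fin m → Permutation′ (suc m)
τ i = transpose (inject₁ i) (Fin.suc i)

toℕ-τ : ∀ {m} (i : Fin m) l → toℕ (τ i ⟨$⟩ʳ l) ≡ swapNext (toℕ i) (toℕ l)
toℕ-τ i l with l FinP.≟ inject₁ i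
... | yes refl = sym (trans (cong (swapNext (toℕ i)) (FinP.toℕ-inject₁ i)) (swapNext-left (toℕ i)))
... | no l≢i with l FinP.≟ Fin.suc i
...   | yes refl = trans (FinP.toℕ-inject₁ i) (sym (swapNext-right (toℕ i)))
...   | no l≢1+i = sym (swapNext-fixed (toℕ i) (toℕ l)
                         (λ l≡i → l≢i (FinP.toℕ-injective (trans l≡i (sym (FinP.toℕ-inject₁ i)))))
                         (l≢1+i ∘ FinP.toℕ-injective))

ltInd : ℕ → ℕ → ℕ
ltInd x y with x <? y
... | yes _ = 1
... | no _  = 0

ltInd-< : ∀ {x y} → x < y → ltInd x y ≡ 1
ltInd-< {x} {y} x<y with x <? y
... | yes _   = refl
... | no x≮y  = contradiction x<y x≮y

ltInd-≮ : ∀ {x y} → ¬ x < y → ltInd x y ≡ 0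
ltInd-≮ {x} {y} x≮y with x <? y
... | yes x<y = contradiction x<y x≮y
... | no _    = refl

ltInd≤1 : ∀ x y → ltInd x y ≤ 1
ltInd≤1 x y with x <? y
... | yes _ = ℕP.≤-refl
... | no _  = z≤n

ltInd-swapNext : ∀ t x y → ¬ (x ≡ t × y ≡ suc t) → ¬ (x ≡ suc t × y ≡ t) →
                 ltInd x y ≡ ltInd (swapNext t x) (swapNext t y)
ltInd-swapNext t x y not-ascending not-descending with x <? y
... | yes x<y = sym (ltInd-< (swapNext-monotone t x y x<y not-ascending))
... | no x≮y  = sym (ltInd-≮ λ swx<swy → x≮y (subst₂ _<_ (swapNext-involutive t x) (swapNext-involutive t y)
      (swapNext-monotone t (swapNext t x) (swapNext t y) swx<swy λ { (swx≡t , swy≡1+t) → not-descending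
        (trans (sym (swapNext-involutive t x)) (trans (cong (swapNext t) swx≡t) (swapNext-left t)) ,
         trans (sym (swapNext-involutive t y)) (trans (cong (swapNext t) swy≡1+t) (swapNext-right t))) })))

nonInversion : ∀ {N} → Permutation′ N → Fin N → Fin N → ℕ
nonInversion w a b = ltInd (toℕ a) (toℕ b) ℕ.* ltInd (value w a) (value w b)

-- the number of non-inversions, ℓ(w₀) - ℓ(w)
ninv : ∀ {N} → Permutation′ N → ℕ
ninv w = FinSum.sum λ a → FinSum.sum λ b → nonInversion w a b

FinSum-zero : ∀ N → FinSum.sum {N} (λ _ → 0) ≡ 0
FinSum-zero zero    = refl
FinSum-zero (suc N) = FinSum-zero N

FinSum-δ : ∀ {N} (j : Fin N) → FinSum.sum (λ b → if does (b FinP.≟ j) then 1 else 0) ≡ 1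
FinSum-δ {suc N} Fin.zero    = cong suc (FinSum-zero N)
FinSum-δ {suc N} (Fin.suc j) = FinSum-δ j

FinSum-≤ : ∀ {N} (f : Fin N → ℕ) c → (∀ x → f x ≤ c) → FinSum.sum f ≤ N ℕ.* c
FinSum-≤ {zero}  f c f≤c = z≤n
FinSum-≤ {suc N} f c f≤c = ℕP.+-mono-≤ (f≤c Fin.zero) (FinSum-≤ (f ∘ Fin.suc) c (f≤c ∘ Fin.suc))

module _ {m : ℕ} (w : Permutation′ (suc m)) (i : Fin m) (ascent : IsAscent w i) where

  private
    t = toℕ i

    swapped : Fin (suc m) → Fin (suc m) → ℕ
    swapped a b = ltInd (swapNext t (toℕ a)) (swapNext t (toℕ b)) ℕ.* ltInd (value w a) (value w b)

    the-ascent : Fin (suc m) → Fin (suc m) → ℕ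
    the-ascent a b = if does (a FinP.≟ inject₁ i) then (if does (b FinP.≟ Fin.suc i) then 1 else 0) else 0

    toℕ-inject₁ : toℕ (inject₁ i) ≡ t
    toℕ-inject₁ = FinP.toℕ-inject₁ i

    ≡inject₁ : ∀ a → toℕ a ≡ t → a ≡ inject₁ i
    ≡inject₁ a a≡t = FinP.toℕ-injective (trans a≡t (sym toℕ-inject₁))

    ninv-·s : ninv (w ·s i) ≡ FinSum.sum (λ a → FinSum.sum (λ b → swapped a b))
    ninv-·s = begin
      ninv (w ·s i)
        ≡⟨ FinSum.sum-cong-≗ (λ a → FinSum.sum-cong-≗ (λ b →
             cong (ℕ._* ltInd (value w (τ i ⟨$⟩ʳ a)) (value w (τ i ⟨$⟩ʳ b)))
               (cong₂ ltInd (trans (sym (swapNext-involutive t (toℕ a))) (cong (swapNext t) (sym (toℕ-τ i a))))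
                            (trans (sym (swapNext-involutive t (toℕ b))) (cong (swapNext t) (sym (toℕ-τ i b))))))) ⟩
      FinSum.sum (λ a → FinSum.sum (λ b → swapped (τ i ⟨$⟩ʳ a) (τ i ⟨$⟩ʳ b)))
        ≡⟨ FinSum.sum-cong-≗ (λ a → sym (FinSum.sum-permute (swapped (τ i ⟨$⟩ʳ a)) (τ i))) ⟩
      FinSum.sum (λ a → FinSum.sum (λ b → swapped (τ i ⟨$⟩ʳ a) b))
        ≡⟨ sym (FinSum.sum-permute (λ a → FinSum.sum (λ b → swapped a b)) (τ i)) ⟩
      FinSum.sum (λ a → FinSum.sum (λ b → swapped a b)) ∎
      where open ≡-Reasoning

    unaffected : ∀ a b → ¬ (a ≡ inject₁ i × b ≡ Fin.suc i) → ¬ (a ≡ Fin.suc i × b ≡ inject₁ i) →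
                 nonInversion w a b ≡ swapped a b
    unaffected a b not-ascending not-descending = cong (ℕ._* ltInd (value w a) (value w b))
      (ltInd-swapNext t (toℕ a) (toℕ b)
        (λ { (a≡t , b≡1+t) → not-ascending (≡inject₁ a a≡t , FinP.toℕ-injective b≡1+t) })
        (λ { (a≡1+t , b≡t) → not-descending (FinP.toℕ-injective a≡1+t , ≡inject₁ b b≡t) }))

    -- only the pair (i, i+1) changes, and it is a non-inversion of w but not of w sᵢ
    nonInversion-split : ∀ a b → nonInversion w a b ≡ swapped a b + the-ascent a b
    nonInversion-split a b with a FinP.≟ inject₁ i | b FinP.≟ Fin.suc i
    ... | yes refl | yes refl = begin
      ltInd (toℕ (inject₁ i)) (suc t) ℕ.* ltInd (value w (inject₁ i)) (value w (Fin.suc i))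
        ≡⟨ cong₂ ℕ._*_ (ltInd-< (subst (_< suc t) (sym toℕ-inject₁) (ℕP.n<1+n t))) (ltInd-< ascent) ⟩
      1
        ≡⟨ sym (cong (λ x → x ℕ.* ltInd (value w (inject₁ i)) (value w (Fin.suc i)) + 1)
                (trans (cong₂ ltInd (trans (cong (swapNext t) toℕ-inject₁) (swapNext-left t)) (swapNext-right t))
                       (ltInd-≮ (ℕP.<-asym (ℕP.n<1+n t))))) ⟩
      swapped (inject₁ i) (Fin.suc i) + 1 ∎
      where open ≡-Reasoning
    ... | yes refl | no b≢1+i = trans (unaffected (inject₁ i) b (λ { (_ , b≡1+i) → b≢1+i b≡1+i })
                                                      (λ { (i≡1+i , _) → inject₁≢suc i i≡1+i }))
                                      (sym (ℕP.+-identityʳ _))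
    ... | no a≢i | _ with a FinP.≟ Fin.suc i | b FinP.≟ inject₁ i
    ...   | yes refl | yes refl = begin
      ltInd (suc t) (toℕ (inject₁ i)) ℕ.* descent  ≡⟨ cong (ℕ._* descent) (ltInd-≮ (ℕP.<-asym i<1+i)) ⟩
      0                                            ≡⟨ trans (cong (ℕ._*_ order) (ltInd-≮ (ℕP.<-asym ascent)))
                                                            (ℕP.*-zeroʳ order) ⟨
      order ℕ.* descent                            ≡⟨ ℕP.+-identityʳ _ ⟨
      swapped (Fin.suc i) (inject₁ i) + 0          ∎
      where
      open ≡-Reasoning
      descent = ltInd (value w (Fin.suc i)) (value w (inject₁ i))
      order   = ltInd (swapNext t (suc t)) (swapNext t (toℕ (inject₁ i)))
      i<1+i : toℕ (inject₁ i) < suc t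
      i<1+i = subst (_< suc t) (sym toℕ-inject₁) (ℕP.n<1+n t)
    ...   | yes refl | no b≢i  = trans (unaffected (Fin.suc i) b (λ { (a≡i , _) → a≢i a≡i })
                                                                (λ { (_ , b≡i) → b≢i b≡i }))
                                       (sym (ℕP.+-identityʳ _))
    ...   | no a≢1+i | _       = trans (unaffected a b (λ { (a≡i , _) → a≢i a≡i })
                                                       (λ { (a≡1+i , _) → a≢1+i a≡1+i }))
                                       (sym (ℕP.+-identityʳ _))

    the-ascent-sum : FinSum.sum (λ a → FinSum.sum (λ b → the-ascent a b)) ≡ 1
    the-ascent-sum = trans (FinSum.sum-cong-≗ row) (FinSum-δ (inject₁ i))
      where
      row : ∀ a → FinSum.sum (λ b → the-ascent a b) ≡ (if does (a FinP.≟ inject₁ i) then 1 else 0)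
      row a with a FinP.≟ inject₁ i
      ... | yes _ = FinSum-δ (Fin.suc i)
      ... | no _  = FinSum-zero (suc m)

  ninv-ascent : ninv w ≡ suc (ninv (w ·s i))
  ninv-ascent = begin
    ninv w
      ≡⟨ FinSum.sum-cong-≗ (λ a → FinSum.sum-cong-≗ (nonInversion-split a)) ⟩
    FinSum.sum (λ a → FinSum.sum (λ b → swapped a b + the-ascent a b))
      ≡⟨ FinSum.sum-cong-≗ (λ a → FinSum.∑-distrib-+ (swapped a) (the-ascent a)) ⟩
    FinSum.sum (λ a → FinSum.sum (swapped a) + FinSum.sum (the-ascent a))
      ≡⟨ FinSum.∑-distrib-+ (λ a → FinSum.sum (swapped a)) (λ a → FinSum.sum (the-ascent a)) ⟩
    FinSum.sum (λ a → FinSum.sum (swapped a)) + FinSum.sum (λ a → FinSum.sum (the-ascent a))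
      ≡⟨ cong₂ _+_ (sym ninv-·s) the-ascent-sum ⟩
    ninv (w ·s i) + 1
      ≡⟨ ℕP.+-comm (ninv (w ·s i)) 1 ⟩
    suc (ninv (w ·s i)) ∎
    where open ≡-Reasoning

ninv< : ∀ {m} (w : Permutation′ (suc m)) → ninv w < suc m ℕ.* suc m
ninv< {m} w = s≤s (ℕP.+-mono-≤
  (subst (FinSum.sum (λ b → nonInversion w Fin.zero (Fin.suc b)) ≤_) (ℕP.*-identityʳ m)
         (FinSum-≤ _ 1 (λ b → nonInversion≤1 Fin.zero (Fin.suc b))))
  (FinSum-≤ _ (suc m) (λ a → subst (FinSum.sum (λ b → nonInversion w (Fin.suc a) b) ≤_)
                                   (ℕP.*-identityʳ (suc m))
                                   (FinSum-≤ _ 1 (λ b → nonInversion≤1 (Fin.suc a) b)))))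
  where
  nonInversion≤1 : ∀ a b → nonInversion w a b ≤ 1
  nonInversion≤1 a b = ℕP.*-mono-≤ (ltInd≤1 (toℕ a) (toℕ b)) (ltInd≤1 (value w a) (value w b))

-- Unfolding the recursion for 𝔊

ninv-·s< : ∀ {m} (w : Permutation′ (suc m)) {i f} → firstAscent w ≡ at i →
           ninv w < suc f → ninv (w ·s i) < f
ninv-·s< w {i} {f} first ninv<1+f =
  subst (_≤ f) (ninv-ascent w i (proj₁ (firstAscent-at w first))) (ℕP.≤-pred ninv<1+f)

-- ninv drops by one at each recursive call of Gaux and starts below the fuel (suc m)², which therefore
-- never runs out
Gaux-stable : ∀ {m} (w : Permutation′ (suc m)) f g → ninv w < f → ninv w < g → Gaux f w ≡ Gaux g w
Gaux-stable w (suc f) (suc g) ninv<1+f ninv<1+g with firstAscent w in first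
... | none = refl
... | at i = cong (π i) (Gaux-stable (w ·s i) f g (ninv-·s< w first ninv<1+f) (ninv-·s< w first ninv<1+g))

𝔊-unfold : ∀ {m} (w : Permutation′ (suc m)) {i} → firstAscent w ≡ at i →
           𝔊 (suc m) w ≡ π i (𝔊 (suc m) (w ·s i))
𝔊-unfold {m} w {i} first rewrite first =
  cong (π i) (Gaux-stable (w ·s i) (m + m ℕ.* suc m) (suc m ℕ.* suc m) ninv<fuel (ℕP.m<n⇒m<1+n ninv<fuel))
  where
  ninv<fuel : ninv (w ·s i) < m + m ℕ.* suc m
  ninv<fuel = ninv-·s< w first (ninv< w)

𝔊-w₀ : ∀ {m} (w : Permutation′ (suc m)) → firstAscent w ≡ none → 𝔊 (suc m) w ≡ Gw₀ (suc m)
𝔊-w₀ w none-first rewrite none-first = refl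

𝔊-decreasing : ∀ {N} (w : Permutation′ N) → DecreasingUpTo w N → 𝔊 N w ≡ Gw₀ N
𝔊-decreasing {zero}  w w↓ = refl
𝔊-decreasing {suc m} w w↓ = 𝔊-w₀ w (firstAscent≡none w w↓)

module _ {a m : ℕ} (σ : Fin (suc a) → Fin (suc m)) (σ-injective : Injective _≡_ _≡_ σ)
         {i : Fin a} {i′ : Fin m}
         (σ-inject₁ : σ (inject₁ i) ≡ inject₁ i′) (σ-suc : σ (Fin.suc i) ≡ Fin.suc i′) where
  open CommutativeSemigroup (*ₚ-commutativeSemigroup (suc m)) using (setoid)
  open import Relation.Binary.Reasoning.Setoid setoid

  𝔊-step : ∀ C → All (SymmetricAt i′) C → ∀ {v w} → firstAscent v ≡ at i → firstAscent w ≡ at i′ →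
           𝔊 (suc m) (w ·s i′) ≈ C *ₚ rename σ (𝔊 (suc a) (v ·s i)) →
           𝔊 (suc m) w ≈ C *ₚ rename σ (𝔊 (suc a) v)
  𝔊-step C C-symmetric {v} {w} v-at w-at step = begin
    𝔊 (suc m) w                  ≡⟨ 𝔊-unfold w w-at ⟩
    π i′ (𝔊 (suc m) (w ·s i′))   ≈⟨ π-cong i′ {𝔊 (suc m) (w ·s i′)} {C *ₚ R} step ⟩
    π i′ (C *ₚ R)                ≈⟨ π-symmetric-factor i′ C R C-symmetric ⟩
    C *ₚ π i′ R                  ≡⟨ cong (C *ₚ_) (AdjacentPair.rename-π σ σ-injective σ-inject₁ σ-suc G) ⟨
    C *ₚ rename σ (π i G)        ≡⟨ cong (λ g → C *ₚ rename σ g) (𝔊-unfold v v-at) ⟨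
    C *ₚ rename σ (𝔊 (suc a) v)  ∎
    where
    G = 𝔊 (suc a) (v ·s i)
    R = rename σ G

-- Concatenation

τ-fixed : ∀ {m} (i : Fin m) l → ¬ toℕ l ≡ toℕ i → ¬ toℕ l ≡ suc (toℕ i) → τ i ⟨$⟩ʳ l ≡ l
τ-fixed i l l≢i l≢1+i =
  FinP.toℕ-injective (trans (toℕ-τ i l) (swapNext-fixed (toℕ i) (toℕ l) l≢i l≢1+i))

shift-adjacent : ∀ {a m c} {σ : Fin (suc a) → Fin (suc m)} → IsShift c σ → (i : Fin a) →
                 Σ (Fin m) λ i* → toℕ i* ≡ c + toℕ i
shift-adjacent {a} {m} {c} {σ} σ-shift i = Fin.fromℕ< c+i<m , FinP.toℕ-fromℕ< c+i<m
  where
  c+i<m : c + toℕ i < m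
  c+i<m = ℕP.≤-pred (subst (_< suc m) (trans (σ-shift (Fin.suc i)) (ℕP.+-suc c (toℕ i)))
                                      (FinP.toℕ<n (σ (Fin.suc i))))

module _ {a m c} {σ : Fin (suc a) → Fin (suc m)} (σ-shift : IsShift c σ)
         {i : Fin a} {i* : Fin m} (toℕ-i* : toℕ i* ≡ c + toℕ i) where

  shift-inject₁ : σ (inject₁ i) ≡ inject₁ i*
  shift-inject₁ = FinP.toℕ-injective (trans (σ-shift (inject₁ i))
    (trans (cong (ℕ._+_ c) (FinP.toℕ-inject₁ i)) (sym (trans (FinP.toℕ-inject₁ i*) toℕ-i*))))

  shift-suc : σ (Fin.suc i) ≡ Fin.suc i*
  shift-suc = FinP.toℕ-injective
    (trans (σ-shift (Fin.suc i)) (trans (ℕP.+-suc c (toℕ i)) (cong suc (sym toℕ-i*))))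

  shift-τ : ∀ j → σ (τ i ⟨$⟩ʳ j) ≡ τ i* ⟨$⟩ʳ σ j
  shift-τ j = FinP.toℕ-injective (begin
    toℕ (σ (τ i ⟨$⟩ʳ j))              ≡⟨ σ-shift (τ i ⟨$⟩ʳ j) ⟩
    c + toℕ (τ i ⟨$⟩ʳ j)              ≡⟨ cong (ℕ._+_ c) (toℕ-τ i j) ⟩
    c + swapNext (toℕ i) (toℕ j)      ≡⟨ swapNext-+ c (toℕ i) (toℕ j) ⟨
    swapNext (c + toℕ i) (c + toℕ j)  ≡⟨ cong₂ swapNext toℕ-i* (σ-shift j) ⟨
    swapNext (toℕ i*) (toℕ (σ j))     ≡⟨ toℕ-τ i* (σ j) ⟨
    toℕ (τ i* ⟨$⟩ʳ σ j)               ∎)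
    where open ≡-Reasoning

record Block {a N : ℕ} (σ : Fin a → Fin N) (d : ℕ) (v : Permutation′ a) (w : Permutation′ N) : Set where
  constructor block
  field
    value-σ : ∀ j → value w (σ j) ≡ value v j + d

module _ {a m d} {σ : Fin (suc a) → Fin (suc m)} {v w} (w-block : Block σ d v w) {i : Fin a} {i* : Fin m}
         (σ-inject₁ : σ (inject₁ i) ≡ inject₁ i*) (σ-suc : σ (Fin.suc i) ≡ Fin.suc i*) where

  private
    values : value w (inject₁ i*) ≡ value v (inject₁ i) + d × value w (Fin.suc i*) ≡ value v (Fin.suc i) + d
    values = trans (cong (value w) (sym σ-inject₁)) (Block.value-σ w-block (inject₁ i)) ,
             trans (cong (value w) (sym σ-suc)) (Block.value-σ w-block (Fin.suc i))

  block-ascent : IsAscent v i → IsAscent w i*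
  block-ascent ascent = subst₂ _<_ (sym (proj₁ values)) (sym (proj₂ values)) (ℕP.+-monoˡ-< d ascent)

block-·s : ∀ {a m d} {σ : Fin (suc a) → Fin (suc m)} {v w} → Block σ d v w →
           ∀ {i i*} → (∀ j → σ (τ i ⟨$⟩ʳ j) ≡ τ i* ⟨$⟩ʳ σ j) → Block σ d (v ·s i) (w ·s i*)
block-·s {w = w} (block value-σ) {i} σ-τ =
  block λ j → trans (cong (value w) (sym (σ-τ j))) (value-σ (τ i ⟨$⟩ʳ j))

block-fixed : ∀ {a m d} {σ : Fin a → Fin (suc m)} {v w} → Block σ d v w →
              ∀ {i*} → (∀ j → τ i* ⟨$⟩ʳ σ j ≡ σ j) → Block σ d v (w ·s i*)
block-fixed {w = w} (block value-σ) τ-fixes = block λ j → trans (cong (value w) (τ-fixes j)) (value-σ j)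

-- positions in w″ = (w′ + n) w: w′ occupies the low positions 0, …, k - 1 and w the high ones k, …, k + n - 1
record Layout (n k N : ℕ) : Set where
  field
    n+k≡N      : n + k ≡ N
    high       : Fin n → Fin N
    low        : Fin k → Fin N
    high-shift : IsShift k high
    low-shift  : IsShift 0 low

standardLayout : ∀ n k → Layout n k (n + k)
standardLayout n k = record
  { n+k≡N      = refl
  ; high       = shiftVar n k
  ; low        = lowVar n k
  ; high-shift = λ j → trans (FinP.toℕ-cast (ℕP.+-comm k n) (k Fin.↑ʳ j)) (FinP.toℕ-↑ʳ k j)
  ; low-shift  = λ j → trans (FinP.toℕ-cast (ℕP.+-comm k n) (j Fin.↑ˡ n)) (FinP.toℕ-↑ˡ j n)
  }

record Concat {n k N : ℕ} (L : Layout n k N)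
              (w″ : Permutation′ N) (w′ : Permutation′ k) (w : Permutation′ n) : Set where
  field
    low-block  : Block (Layout.low L) n w′ w″
    high-block : Block (Layout.high L) 0 w w″

module Concatenation {n k m : ℕ} (L : Layout n k (suc m)) where
  open Layout L public

  lowExponents : Mon (suc m)
  lowExponents = tabulate λ l → if does (toℕ l <? k) then n else 0

  product : Permutation′ n → Permutation′ k → Poly (suc m)
  product w w′ = (rename high (𝔊 n w) *ₚ rename low (𝔊 k w′)) *ₚ term (+ 1) lowExponents

  high-injective : Injective _≡_ _≡_ high
  high-injective = shift-injective high-shift

  low-injective : Injective _≡_ _≡_ low
  low-injective = shift-injective low-shift

  low<k : ∀ j → toℕ (low j) < k
  low<k j = subst (_< k) (sym (low-shift j)) (FinP.toℕ<n j)

  k≤high : ∀ j → k ≤ toℕ (high j)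
  k≤high j = subst (k ≤_) (sym (high-shift j)) (ℕP.m≤m+n k (toℕ j))

  data Position : Fin (suc m) → Set where
    lowPosition  : ∀ j → Position (low j)
    highPosition : ∀ j → Position (high j)

  position : ∀ l → Position l
  position l with toℕ l <? k
  ... | yes l<k = let j , low-j≡l = shift-preimage low-shift l z≤n l<k
                  in subst Position low-j≡l (lowPosition j)
  ... | no l≮k  = let j , high-j≡l = shift-preimage high-shift l (ℕP.≮⇒≥ l≮k) l<k+n
                  in subst Position high-j≡l (highPosition j)
    where
    l<k+n : toℕ l < k + n
    l<k+n = subst (toℕ l <_) (trans (sym n+k≡N) (ℕP.+-comm n k)) (FinP.toℕ<n l)

  lookup-lowExponents-low : ∀ j → lookup lowExponents (low j) ≡ n
  lookup-lowExponents-low j =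
    trans (VecP.lookup∘tabulate (λ l → if does (toℕ l <? k) then n else 0) (low j))
          (cong (if_then n else 0) (dec-true (toℕ (low j) <? k) (low<k j)))

  lookup-lowExponents-high : ∀ j → lookup lowExponents (high j) ≡ 0
  lookup-lowExponents-high j =
    trans (VecP.lookup∘tabulate (λ l → if does (toℕ l <? k) then n else 0) (high j))
          (cong (if_then n else 0) (dec-false (toℕ (high j) <? k) (ℕP.≤⇒≯ (k≤high j))))

  low≢high : ∀ j j′ → ¬ low j ≡ high j′
  low≢high j j′ low≡high = ℕP.<⇒≱ (low<k j) (subst (k ≤_) (sym (cong toℕ low≡high)) (k≤high j′))

  module _ {i* : Fin m} where

    τ-fixes-low : ∀ {a} → high a ≡ inject₁ i* → ∀ j → τ i* ⟨$⟩ʳ low j ≡ low j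
    τ-fixes-low {a} high-a≡i* j = τ-fixed i* (low j) (ℕP.<⇒≢ (ℕP.<-≤-trans (low<k j) k≤i*))
                                              (ℕP.<⇒≢ (ℕP.<-≤-trans (low<k j) (ℕP.m≤n⇒m≤1+n k≤i*)))
      where
      k≤i* : k ≤ toℕ i*
      k≤i* = subst (k ≤_) (trans (cong toℕ high-a≡i*) (FinP.toℕ-inject₁ i*)) (k≤high a)

    τ-fixes-high : ∀ {b} → low b ≡ Fin.suc i* → ∀ j → τ i* ⟨$⟩ʳ high j ≡ high j
    τ-fixes-high {b} low-b≡1+i* j = τ-fixed i* (high j)
      (λ j≡i* → ℕP.<⇒≱ (ℕP.<-trans (ℕP.n<1+n (toℕ i*)) 1+i*<k) (subst (k ≤_) j≡i* (k≤high j)))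
      (λ j≡1+i* → ℕP.<⇒≱ 1+i*<k (subst (k ≤_) j≡1+i* (k≤high j)))
      where
      1+i*<k : suc (toℕ i*) < k
      1+i*<k = subst (_< k) (cong toℕ low-b≡1+i*) (low<k b)

    lowFactor-symmetric : ∀ {a b} → high a ≡ inject₁ i* → high b ≡ Fin.suc i* →
                          ∀ g → All (SymmetricAt i*) (rename low g *ₚ term (+ 1) lowExponents)
    lowFactor-symmetric {a} {b} high-a≡i* high-b≡1+i* g =
      *ₚ-symmetric i* (rename low g) (term (+ 1) lowExponents)
      (rename-symmetric low i* (λ j low-j≡i* → low≢high j a (trans low-j≡i* (sym high-a≡i*)))
                               (λ j low-j≡1+i* → low≢high j b (trans low-j≡1+i* (sym high-b≡1+i*))) g)
      (trans (cong (lookup lowExponents) (sym high-a≡i*))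
             (trans (lookup-lowExponents-high a)
                    (sym (trans (cong (lookup lowExponents) (sym high-b≡1+i*)) (lookup-lowExponents-high b))))
       ∷ [])

    highFactor-symmetric : ∀ {a b} → low a ≡ inject₁ i* → low b ≡ Fin.suc i* →
                           ∀ g → All (SymmetricAt i*) (rename high g *ₚ term (+ 1) lowExponents)
    highFactor-symmetric {a} {b} low-a≡i* low-b≡1+i* g =
      *ₚ-symmetric i* (rename high g) (term (+ 1) lowExponents)
      (rename-symmetric high i* (λ j high-j≡i* → low≢high a j (trans low-a≡i* (sym high-j≡i*)))
                                (λ j high-j≡1+i* → low≢high b j (trans low-b≡1+i* (sym high-j≡1+i*))) g)
      (trans (cong (lookup lowExponents) (sym low-a≡i*))
             (trans (lookup-lowExponents-low a)
                    (sym (trans (cong (lookup lowExponents) (sym low-b≡1+i*)) (lookup-lowExponents-low b))))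
       ∷ [])

  module _ {w″ w′ w} (concat : Concat L w″ w′ w) where
    open Concat concat
    open Block low-block renaming (value-σ to low-value)
    open Block high-block renaming (value-σ to high-value)

    private
      low-pair : ∀ {p} → DecreasingUpTo w′ p → ∀ ja jb → toℕ (low jb) ≡ suc (toℕ (low ja)) →
                 toℕ ja < p → value w″ (low jb) ≤ value w″ (low ja)
      low-pair w′↓ ja jb adjacent ja<p = subst₂ _≤_ (sym (low-value jb)) (sym (low-value ja))
        (ℕP.+-monoˡ-≤ n (w′↓ ja jb (trans (sym (low-shift jb)) (trans adjacent (cong suc (low-shift ja)))) ja<p))

    concat-decreasingˡ : ∀ {p} → DecreasingUpTo w′ p → p < k → DecreasingUpTo w″ p
    concat-decreasingˡ {p} w′↓ p<k a b b≡1+a a<p with position a | position b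
    ... | lowPosition ja  | lowPosition jb  = low-pair w′↓ ja jb b≡1+a (subst (_< p) (low-shift ja) a<p)
    ... | highPosition ja | _               = contradiction (ℕP.<-trans a<p p<k) (ℕP.≤⇒≯ (k≤high ja))
    ... | lowPosition ja  | highPosition jb =
      contradiction (ℕP.<-≤-trans (s≤s a<p) p<k) (ℕP.≤⇒≯ (subst (k ≤_) b≡1+a (k≤high jb)))

    concat-decreasing : DecreasingUpTo w′ k → ∀ {p} → DecreasingUpTo w p → DecreasingUpTo w″ (k + p)
    concat-decreasing w′↓ {p} w↓ a b b≡1+a a<k+p with position a | position b
    ... | lowPosition ja  | lowPosition jb  = low-pair w′↓ ja jb b≡1+a (FinP.toℕ<n ja)
    ... | highPosition ja | highPosition jb = subst₂ _≤_ (sym (high-value jb)) (sym (high-value ja))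
      (ℕP.+-monoˡ-≤ 0 (w↓ ja jb adjacent (ℕP.+-cancelˡ-< k (toℕ ja) p (subst (_< k + p) (high-shift ja) a<k+p))))
      where
      adjacent : toℕ jb ≡ suc (toℕ ja)
      adjacent = ℕP.+-cancelˡ-≡ k (toℕ jb) (suc (toℕ ja))
        (trans (sym (high-shift jb)) (trans b≡1+a (trans (cong suc (high-shift ja)) (sym (ℕP.+-suc k (toℕ ja))))))
    ... | lowPosition ja  | highPosition jb = subst₂ _≤_ (sym (high-value jb)) (sym (low-value ja))
      (ℕP.≤-trans (ℕP.<⇒≤ (subst (_< n) (sym (ℕP.+-identityʳ _)) (FinP.toℕ<n (w ⟨$⟩ʳ jb))))
                  (ℕP.m≤n+m n (value w′ ja)))
    ... | highPosition ja | lowPosition jb  =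
      contradiction (low<k jb) (ℕP.≤⇒≯ (subst (k ≤_) (sym b≡1+a) (ℕP.m≤n⇒m≤1+n (k≤high ja))))

  staircase-split : Gw₀ (suc m) ≡ (rename high (Gw₀ n) *ₚ rename low (Gw₀ k)) *ₚ term (+ 1) lowExponents
  staircase-split = cong (λ e → (+ 1 , e) ∷ []) (lookup-ext pointwise)
    where
    staircase : ∀ N → Mon N
    staircase N = tabulate λ j → N ∸ suc (toℕ j)

    lookup-staircase : ∀ {N} j → lookup (staircase N) j ≡ N ∸ suc (toℕ j)
    lookup-staircase {N} = VecP.lookup∘tabulate (λ j → N ∸ suc (toℕ j))

    low-arithmetic : ∀ t → t < k → m ∸ t ≡ (k ∸ suc t) + n
    low-arithmetic t t<k = begin
      m ∸ t              ≡⟨ cong (_∸ suc t) (sym n+k≡N) ⟩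
      (n + k) ∸ suc t    ≡⟨ ℕP.+-∸-assoc n t<k ⟩
      n + (k ∸ suc t)    ≡⟨ ℕP.+-comm n (k ∸ suc t) ⟩
      (k ∸ suc t) + n    ∎
      where open ≡-Reasoning

    high-arithmetic : ∀ t → m ∸ (k + t) ≡ n ∸ suc t
    high-arithmetic t = begin
      m ∸ (k + t)                ≡⟨ cong₂ _∸_ (sym n+k≡N) (cong suc (ℕP.+-comm k t)) ⟩
      (n + k) ∸ (suc t + k)      ≡⟨ cong₂ _∸_ (ℕP.+-comm n k) (ℕP.+-comm (suc t) k) ⟩
      (k + n) ∸ (k + suc t)      ≡⟨ ℕP.[m+n]∸[m+o]≡n∸o k n (suc t) ⟩
      n ∸ suc t                  ∎
      where open ≡-Reasoning

    highExponents = renameMon high (staircase n)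
    lowBlockExponents = renameMon low (staircase k)
    exponents = (highExponents +ₘ lowBlockExponents) +ₘ lowExponents

    lookup-exponents : ∀ l → lookup exponents l ≡
      (lookup highExponents l + lookup lowBlockExponents l) + lookup lowExponents l
    lookup-exponents l = trans (lookup-+ₘ (highExponents +ₘ lowBlockExponents) lowExponents l)
      (cong (_+ lookup lowExponents l) (lookup-+ₘ highExponents lowBlockExponents l))

    pointwise : ∀ l → lookup (staircase (suc m)) l ≡ lookup exponents l
    pointwise l with position l
    ... | lowPosition j = begin
      lookup (staircase (suc m)) (low j)  ≡⟨ trans (lookup-staircase (low j)) (cong (m ∸_) (low-shift j)) ⟩
      m ∸ toℕ j                           ≡⟨ low-arithmetic (toℕ j) (FinP.toℕ<n j) ⟩
      (0 + (k ∸ suc (toℕ j))) + n         ≡⟨ cong₂ _+_ (cong₂ _+_ high-part low-part) (lookup-lowExponents-low j) ⟨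
      (lookup highExponents (low j) + lookup lowBlockExponents (low j)) + lookup lowExponents (low j)
                                          ≡⟨ lookup-exponents (low j) ⟨
      lookup exponents (low j)            ∎
      where
      open ≡-Reasoning
      high-part : lookup highExponents (low j) ≡ 0
      high-part = lookup-renameMon-outside high (staircase n) (low j) (λ j′ → low≢high j j′ ∘ sym)
      low-part : lookup lowBlockExponents (low j) ≡ k ∸ suc (toℕ j)
      low-part = trans (lookup-renameMon-image low low-injective (staircase k) j) (lookup-staircase j)
    ... | highPosition j = begin
      lookup (staircase (suc m)) (high j) ≡⟨ trans (lookup-staircase (high j)) (cong (m ∸_) (high-shift j)) ⟩
      m ∸ (k + toℕ j)                     ≡⟨ high-arithmetic (toℕ j) ⟩
      n ∸ suc (toℕ j)                     ≡⟨ trans (ℕP.+-identityʳ _) (ℕP.+-identityʳ _) ⟨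
      (n ∸ suc (toℕ j) + 0) + 0           ≡⟨ cong₂ _+_ (cong₂ _+_ high-part low-part) (lookup-lowExponents-high j) ⟨
      (lookup highExponents (high j) + lookup lowBlockExponents (high j)) + lookup lowExponents (high j)
                                          ≡⟨ lookup-exponents (high j) ⟨
      lookup exponents (high j)           ∎
      where
      open ≡-Reasoning
      high-part : lookup highExponents (high j) ≡ n ∸ suc (toℕ j)
      high-part = trans (lookup-renameMon-image high high-injective (staircase n) j) (lookup-staircase j)
      low-part : lookup lowBlockExponents (high j) ≡ 0
      low-part = lookup-renameMon-outside low (staircase k) (high j) (λ j′ → low≢high j′ j)

  concat-w₀ : ∀ {w″ w′ w} → Concat L w″ w′ w → DecreasingUpTo w′ k → DecreasingUpTo w n →
              𝔊 (suc m) w″ ≈ product w w′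
  concat-w₀ {w″} {w′} {w} concat w′↓ w↓ e = cong (λ p → coeff p e) (begin
    𝔊 (suc m) w″
      ≡⟨ 𝔊-decreasing w″ (subst (DecreasingUpTo w″) k+n≡1+m (concat-decreasing concat w′↓ w↓)) ⟩
    Gw₀ (suc m)
      ≡⟨ staircase-split ⟩
    (rename high (Gw₀ n) *ₚ rename low (Gw₀ k)) *ₚ term (+ 1) lowExponents
      ≡⟨ sym (cong₂ (λ g g′ → (rename high g *ₚ rename low g′) *ₚ term (+ 1) lowExponents)
                    (𝔊-decreasing w w↓) (𝔊-decreasing w′ w′↓)) ⟩
    product w w′ ∎)
    where
    open ≡-Reasoning
    k+n≡1+m : k + n ≡ suc m
    k+n≡1+m = trans (ℕP.+-comm k n) n+k≡N

module _ {n k m : ℕ} (L : Layout (suc n) k (suc m)) where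
  open Concatenation L
  open CommutativeSemigroup (*ₚ-commutativeSemigroup (suc m)) using (setoid)
  open CommutativeSemigroupProperties (*ₚ-commutativeSemigroup (suc m)) using (xy∙z≈yz∙x)
  open import Relation.Binary.Reasoning.Setoid setoid

  concat-𝔊-high : ∀ f {w″ w′ w} → ninv w < f → Concat L w″ w′ w → DecreasingUpTo w′ k →
                  𝔊 (suc m) w″ ≈ product w w′
  concat-𝔊-high (suc f) {w″} {w′} {w} ninv<f concat w′↓ = by-first-ascent (firstAscent w) refl
    where
    open Concat concat
    by-first-ascent : (a : Ascent w) → firstAscent w ≡ a → 𝔊 (suc m) w″ ≈ product w w′
    by-first-ascent none   w-first = concat-w₀ concat w′↓ (firstAscent-none w w-first)
    by-first-ascent (at i) w-first = begin
      𝔊 (suc m) w″   ≈⟨ 𝔊-step high high-injective i*-inject₁ i*-suc C C-symmetric w-first w″-first step ⟩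
      (B *ₚ P) *ₚ A  ≈˘⟨ xy∙z≈yz∙x A B P ⟩
      product w w′   ∎
      where
      i*          = proj₁ (shift-adjacent high-shift i)
      toℕ-i*      = proj₂ (shift-adjacent high-shift i)
      i*-inject₁  = shift-inject₁ high-shift toℕ-i*
      i*-suc      = shift-suc high-shift toℕ-i*
      A = rename high (𝔊 (suc n) w)
      B = rename low (𝔊 k w′)
      P = term (+ 1) lowExponents
      C = B *ₚ P

      w″-first : firstAscent w″ ≡ at i*
      w″-first = firstAscent≡at w″ (block-ascent high-block i*-inject₁ i*-suc (proj₁ w-spec))
        (subst (DecreasingUpTo w″) (sym toℕ-i*) (concat-decreasing concat w′↓ (proj₂ w-spec)))
        where w-spec = firstAscent-at w w-first

      C-symmetric : All (SymmetricAt i*) C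
      C-symmetric = lowFactor-symmetric i*-inject₁ i*-suc (𝔊 k w′)

      concat′ : Concat L (w″ ·s i*) w′ (w ·s i)
      concat′ = record
        { low-block  = block-fixed low-block (τ-fixes-low i*-inject₁)
        ; high-block = block-·s high-block (shift-τ high-shift toℕ-i*)
        }

      step : 𝔊 (suc m) (w″ ·s i*) ≈ C *ₚ rename high (𝔊 (suc n) (w ·s i))
      step = begin
        𝔊 (suc m) (w″ ·s i*)  ≈⟨ concat-𝔊-high f (ninv-·s< w w-first ninv<f) concat′ w′↓ ⟩
        product (w ·s i) w′   ≈⟨ xy∙z≈yz∙x (rename high (𝔊 (suc n) (w ·s i))) B P ⟩
        C *ₚ rename high (𝔊 (suc n) (w ·s i)) ∎

concat-𝔊-decreasingˡ : ∀ {n k m} (L : Layout n k (suc m)) {w″ w′ w} → Concat L w″ w′ w →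
                       DecreasingUpTo w′ k → 𝔊 (suc m) w″ ≈ Concatenation.product L w w′
concat-𝔊-decreasingˡ {zero}  L         concat w′↓ = Concatenation.concat-w₀ L concat w′↓ λ ()
concat-𝔊-decreasingˡ {suc n} L {w = w} concat w′↓ = concat-𝔊-high L (suc (ninv w)) ℕP.≤-refl concat w′↓

module _ {n k m : ℕ} (L : Layout n (suc k) (suc m)) where
  open Concatenation L
  open CommutativeSemigroup (*ₚ-commutativeSemigroup (suc m)) using (setoid)
  open CommutativeSemigroupProperties (*ₚ-commutativeSemigroup (suc m)) using (xy∙z≈xz∙y)
  open import Relation.Binary.Reasoning.Setoid setoid

  concat-𝔊-low : ∀ f {w″ w′ w} → ninv w′ < f → Concat L w″ w′ w → 𝔊 (suc m) w″ ≈ product w w′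
  concat-𝔊-low (suc f) {w″} {w′} {w} ninv<f concat = by-first-ascent (firstAscent w′) refl
    where
    open Concat concat
    by-first-ascent : (a : Ascent w′) → firstAscent w′ ≡ a → 𝔊 (suc m) w″ ≈ product w w′
    by-first-ascent none   w′-first = concat-𝔊-decreasingˡ L concat (firstAscent-none w′ w′-first)
    by-first-ascent (at i) w′-first = begin
      𝔊 (suc m) w″   ≈⟨ 𝔊-step low low-injective i*-inject₁ i*-suc C C-symmetric w′-first w″-first step ⟩
      (A *ₚ P) *ₚ B  ≈˘⟨ xy∙z≈xz∙y A B P ⟩
      product w w′   ∎
      where
      i*          = proj₁ (shift-adjacent low-shift i)
      toℕ-i*      = proj₂ (shift-adjacent low-shift i)
      i*-inject₁  = shift-inject₁ low-shift toℕ-i*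
      i*-suc      = shift-suc low-shift toℕ-i*
      A = rename high (𝔊 n w)
      B = rename low (𝔊 (suc k) w′)
      P = term (+ 1) lowExponents
      C = A *ₚ P

      w″-first : firstAscent w″ ≡ at i*
      w″-first = firstAscent≡at w″ (block-ascent low-block i*-inject₁ i*-suc (proj₁ w′-spec))
        (subst (DecreasingUpTo w″) (sym toℕ-i*)
               (concat-decreasingˡ concat (proj₂ w′-spec) (ℕP.m<n⇒m<1+n (FinP.toℕ<n i))))
        where w′-spec = firstAscent-at w′ w′-first

      C-symmetric : All (SymmetricAt i*) C
      C-symmetric = highFactor-symmetric i*-inject₁ i*-suc (𝔊 n w)

      concat′ : Concat L (w″ ·s i*) (w′ ·s i) w
      concat′ = record
        { low-block  = block-·s low-block (shift-τ low-shift toℕ-i*)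
        ; high-block = block-fixed high-block (τ-fixes-high i*-suc)
        }

      step : 𝔊 (suc m) (w″ ·s i*) ≈ C *ₚ rename low (𝔊 (suc k) (w′ ·s i))
      step = begin
        𝔊 (suc m) (w″ ·s i*)  ≈⟨ concat-𝔊-low f (ninv-·s< w′ w′-first ninv<f) concat′ ⟩
        product w (w′ ·s i)   ≈⟨ xy∙z≈xz∙y A (rename low (𝔊 (suc k) (w′ ·s i))) P ⟩
        C *ₚ rename low (𝔊 (suc k) (w′ ·s i)) ∎

concat-𝔊 : ∀ {n k m} (L : Layout n k (suc m)) {w″ w′ w} → Concat L w″ w′ w →
           𝔊 (suc m) w″ ≈ Concatenation.product L w w′
concat-𝔊 {k = zero}  L           concat = concat-𝔊-decreasingˡ L concat λ ()
concat-𝔊 {k = suc k} L {w′ = w′} concat = concat-𝔊-low L (suc (ninv w′)) ℕP.≤-refl concat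

-- One-line notation

-- with a junk value 0 past the end of the list
nth : List ℕ → ℕ → ℕ
nth []       _       = 0
nth (x ∷ xs) zero    = x
nth (x ∷ xs) (suc i) = nth xs i

nth-++ˡ : ∀ (xs ys : List ℕ) i → i < length xs → nth (xs ++ ys) i ≡ nth xs i
nth-++ˡ (x ∷ xs) ys zero    _           = refl
nth-++ˡ (x ∷ xs) ys (suc i) (s≤s i<xs) = nth-++ˡ xs ys i i<xs

nth-++ʳ : ∀ (xs ys : List ℕ) i → nth (xs ++ ys) (length xs + i) ≡ nth ys i
nth-++ʳ []       ys i = refl
nth-++ʳ (x ∷ xs) ys i = nth-++ʳ xs ys i

nth-map : ∀ (f : ℕ → ℕ) (xs : List ℕ) i → i < length xs → nth (map f xs) i ≡ f (nth xs i)
nth-map f (x ∷ xs) zero    _           = refl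
nth-map f (x ∷ xs) (suc i) (s≤s i<xs) = nth-map f xs i i<xs

length-oneLine : ∀ {N} (w : Permutation′ N) → length (oneLine w) ≡ N
length-oneLine {N} w = trans (ListP.length-map _ (allFin N)) (ListP.length-tabulate id)

nth-oneLine : ∀ {N} (w : Permutation′ N) j → nth (oneLine w) (toℕ j) ≡ suc (value w j)
nth-oneLine {N} w j =
  trans (cong (λ xs → nth xs (toℕ j)) (ListP.map-tabulate id (λ x → suc (value w x)))) (nth-tabulate _ j)
  where
  nth-tabulate : ∀ {K} (f : Fin K → ℕ) (j : Fin K) → nth (List.tabulate f) (toℕ j) ≡ f j
  nth-tabulate f Fin.zero    = refl
  nth-tabulate f (Fin.suc j) = nth-tabulate (f ∘ Fin.suc) j

oneLine-concat : ∀ {n k} (w : Permutation′ n) (w′ : Permutation′ k) (w″ : Permutation′ (n + k)) →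
                 oneLine w″ ≡ map (λ v → v + n) (oneLine w′) ++ oneLine w →
                 Concat (standardLayout n k) w″ w′ w
oneLine-concat {n} {k} w w′ w″ oneLine≡ = record
  { low-block  = block λ j → ℕP.suc-injective (begin
      suc (value w″ (low j))                   ≡⟨ sym (nth-oneLine w″ (low j)) ⟩
      nth (oneLine w″) (toℕ (low j))           ≡⟨ cong₂ nth oneLine≡ (low-shift j) ⟩
      nth (raised ++ oneLine w) (toℕ j)        ≡⟨ nth-++ˡ raised (oneLine w) (toℕ j)
                                                   (subst (toℕ j <_) (sym length-raised) (FinP.toℕ<n j)) ⟩
      nth raised (toℕ j)                       ≡⟨ nth-map (λ v → v + n) (oneLine w′) (toℕ j)
                                                   (subst (toℕ j <_) (sym (length-oneLine w′)) (FinP.toℕ<n j)) ⟩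
      nth (oneLine w′) (toℕ j) + n             ≡⟨ cong (_+ n) (nth-oneLine w′ j) ⟩
      suc (value w′ j + n)                     ∎)
  ; high-block = block λ j → ℕP.suc-injective (begin
      suc (value w″ (high j))                  ≡⟨ sym (nth-oneLine w″ (high j)) ⟩
      nth (oneLine w″) (toℕ (high j))          ≡⟨ cong₂ nth oneLine≡
                                                   (trans (high-shift j) (cong (_+ toℕ j) (sym length-raised))) ⟩
      nth (raised ++ oneLine w) (length raised + toℕ j) ≡⟨ nth-++ʳ raised (oneLine w) (toℕ j) ⟩
      nth (oneLine w) (toℕ j)                  ≡⟨ nth-oneLine w j ⟩
      suc (value w j)                          ≡⟨ cong suc (sym (ℕP.+-identityʳ _)) ⟩
      suc (value w j + 0)                      ∎)
  }
  where
  open ≡-Reasoning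
  open Layout (standardLayout n k)
  raised = map (λ v → v + n) (oneLine w′)
  length-raised : length raised ≡ k
  length-raised = trans (ListP.length-map _ (oneLine w′)) (length-oneLine w′)

theorem5p7 : (n k : ℕ) (w : Permutation′ n) (w′ : Permutation′ k) (w″ : Permutation′ (n + k)) →
    oneLine w″ ≡ map (λ v → v + n) (oneLine w′) ++ oneLine w →
    𝔊 (n + k) w″ ≈ (rename (shiftVar n k) (𝔊 n w) *ₚ rename (lowVar n k) (𝔊 k w′)) *ₚ lowPower n k
theorem5p7 zero    zero    w w′ w″ oneLine≡ e = refl
theorem5p7 zero    (suc k) w w′ w″ oneLine≡   =
  concat-𝔊 (standardLayout zero (suc k)) (oneLine-concat w w′ w″ oneLine≡)
theorem5p7 (suc n) k       w w′ w″ oneLine≡   =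
  concat-𝔊 (standardLayout (suc n) k) (oneLine-concat w w′ w″ oneLine≡)
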